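{- Let $n\ge 1$ and let $V_n$ be the set of partitions of type $B_n$ without zero-block. For $\pi\in V_n$ let $s_\pi$ be the number of singleton pairs and $a_\pi$ the number of adjacency pairs of $\pi$, and put \[ P_n(x,y)=\sum_{\pi\in V_n}x^{s_{\pi}}y^{a_{\pi}}. \] Then $P_n(x,y)=P_n(y,x)$; that is, the joint distribution of $(s_\pi,a_\pi)$ over $V_n$ is symmetric.
   Context: Let $[\pm n]=\{\pm1,\pm2,\ldots,\pm n\}$. A partition of type $B_n$ is a set partition $\pi$ of $[\pm n]$ such that for every block $B$ of $\pi$, $-B=\{ -b: b\in B\}$ is also a block of $\pi$, and there is at most one block $B$ with $B=-B$; such a block is called the zero-block. $V_n$ denotes the set of type $B_n$ partitions having no zero-block. For $\pi\in V_n$, $\pm i$ (with $i\in[n]$) is a singleton pair of $\pi$ if $\{i\}$ is a block of $\pi$ (equivalently $\{i\}$ and $\{ -i\}$ are blocks); $s_\pi$ is the number of such $i\in[n]$. For $j\in[n]$, $\pm(j,j+1)$ is an adjacency pair of $\pi$ if $j$ and $j+1$ lie in the same block of $\pi$, where $j+1$ is taken modulo $n$ (so $n+1$ means $1$); $a_\pi$ is the number of such $j\in[n]$. (For $n=1$ the unique partition $\{\{1\},\{ -1\}\}$ has one singleton pair and one adjacency pair.) -}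

module Defs where

open import Data.Bool using (Bool; true; false; _∧_; _∨_; not; if_then_else_)
open import Data.Nat using (ℕ; zero; suc; _<?_; _≡ᵇ_)
open import Data.Fin using (Fin; toℕ; fromℕ<) renaming (zero to fzero; suc to fsuc)
open import Data.Fin.Properties using () renaming (_≟_ to _≟ᶠ_)
open import Data.List using (List; []; _∷_; map; concatMap; filter; length; allFin; foldr)
open import Relation.Nullary using (yes; no)
open import Relation.Nullary.Decidable using (⌊_⌋)
open import Data.Bool.Properties using () renaming (_≟_ to _≟ᵇ_)
open import Relation.Unary using (Decidable)
open import Data.Bool using (T)
open import Data.Bool.Properties using (T?)

-- Elements of [±n]: a pair (σ , i) with σ : Bool a sign (false = +,
-- true = −) and i : Fin n standing for the absolute value i+1.
-- So (false , i) is +(i+1) and (true , i) is −(i+1).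

eqE : ∀ {n} → Bool → Fin n → Bool → Fin n → Bool
eqE σ i τ j = ⌊ σ ≟ᵇ τ ⌋ ∧ ⌊ i ≟ᶠ j ⌋

Rel± : ℕ → Set
Rel± n = Bool → Fin n → Bool → Fin n → Bool

-- Enumeration of all functions (each extensional function exactly once)

allFinFun : {A : Set} → List A → (n : ℕ) → List (Fin n → A)
allFinFun xs zero    = (λ ()) ∷ []
allFinFun xs (suc n) =
  concatMap (λ a → map (λ f → λ { fzero → a ; (fsuc k) → f k }) (allFinFun xs n)) xs

allBoolFun : {A : Set} → List A → List (Bool → A)
allBoolFun xs =
  concatMap (λ a → map (λ b → λ { false → a ; true → b }) xs) xs

allRel± : (n : ℕ) → List (Rel± n)
allRel± n = allBoolFun (allFinFun (allBoolFun (allFinFun (false ∷ true ∷ []) n)) n)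

allL : {A : Set} → (A → Bool) → List A → Bool
allL p = foldr (λ a b → p a ∧ b) true

allE : ∀ {n} → (Bool → Fin n → Bool) → Bool
allE {n} p = allL (λ σ → allL (λ i → p σ i) (allFin n)) (false ∷ true ∷ [])

_⇒ᵇ_ : Bool → Bool → Bool
a ⇒ᵇ b = not a ∨ b

_⇔ᵇ_ : Bool → Bool → Bool
a ⇔ᵇ b = (a ⇒ᵇ b) ∧ (b ⇒ᵇ a)

-- A set partition of [±n] is encoded by its equivalence relation
-- "x and y lie in the same block" (partitions ↔ equivalence relations).

isEquiv : ∀ {n} → Rel± n → Bool
isEquiv R =
  allE (λ σ i → R σ i σ i) ∧
  allE (λ σ i → allE (λ τ j → R σ i τ j ⇒ᵇ R τ j σ i)) ∧
  allE (λ σ i → allE (λ τ j → allE (λ ρ k → (R σ i τ j ∧ R τ j ρ k) ⇒ᵇ R σ i ρ k)))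

-- type B_n condition: for every block B, -B is a block, i.e. negation
-- maps blocks to blocks: x ~ y iff -x ~ -y.
isTypeB : ∀ {n} → Rel± n → Bool
isTypeB R = allE (λ σ i → allE (λ τ j → R σ i τ j ⇔ᵇ R (not σ) i (not τ) j))

-- no zero-block: for no element x is its block B = {y | x ~ y} equal
-- (as a set) to -B = {y | x ~ -y}.
noZeroBlock : ∀ {n} → Rel± n → Bool
noZeroBlock R = allE (λ σ i → not (allE (λ τ j → R σ i τ j ⇔ᵇ R σ i (not τ) j)))

inV : ∀ {n} → Rel± n → Bool
inV R = isEquiv R ∧ isTypeB R ∧ noZeroBlock R

-- {i+1} is a block: the only element related to +(i+1) is +(i+1) itself
isSingleton : ∀ {n} → Rel± n → Fin n → Bool
isSingleton R i = allE (λ τ j → R false i τ j ⇒ᵇ eqE false i τ j)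

sStat : ∀ {n} → Rel± n → ℕ
sStat {n} R = length (filter (λ i → T? (isSingleton R i)) (allFin n))

-- cyclic successor on Fin n (index i stands for i+1, so this is j ↦ j+1 mod n)
nextMod : ∀ {n} → Fin n → Fin n
nextMod {suc m} i with suc (toℕ i) <? suc m
... | yes p = fromℕ< p
... | no _  = fzero

-- ±(j,j+1) is an adjacency pair: j and j+1 (mod n) in the same block
isAdjacency : ∀ {n} → Rel± n → Fin n → Bool
isAdjacency R j = R false j false (nextMod j)

aStat : ∀ {n} → Rel± n → ℕ
aStat {n} R = length (filter (λ j → T? (isAdjacency R j)) (allFin n))

-- coefficient of x^p y^q in P_n(x,y) = Σ_{π ∈ V_n} x^{s_π} y^{a_π}

coeffP : (n p q : ℕ) → ℕ
coeffP n p q =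
  length (filter (λ R → T? (inV R ∧ (sStat R ≡ᵇ p) ∧ (aStat R ≡ᵇ q))) (allRel± n))

module Submission where

-- For marks S, A ⊆ [n] let N(S, A) count the π ∈ V_n in which every i ∈ S is
-- a singleton pair and every j ∈ A starts an adjacency pair ±(j, j+1).  For
-- n ≥ 2, N(S, A) = 0 unless the marks are compatible (no marked singleton
-- touches a marked adjacency), and then N(S, A) = |V_{n−|S|−|A|}|: after a
-- cyclic rotation, deleting a marked singleton or merging across a marked
-- adjacency is a bijection onto V_{n−1}.  Compatibility and |S| + |A| are
-- invariant under the duality (S, A) ↦ (A − 1, S), so
-- E(k, l) = Σ_{|S|=k, |A|=l} N(S, A) is symmetric in k and l.  Double counting
-- gives E(k, l) = Σ_{p,q} C(p,k) C(q,l) [x^p y^q] P_n, and this binomial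
-- transform is injective (triangular with unit diagonal), so the
-- coefficients of P_n are symmetric as well.

open import Data.Bool using (Bool; true; false; _∧_; not; T)
open import Data.Bool.Properties using (T?; T-∧; not-involutive; ∧-zeroʳ) renaming (_≟_ to _≟ᵇ_)
open import Data.Nat using (ℕ; zero; suc; _+_; _*_; _∸_; _<_; _≤_; _<?_; _≤?_; _≡ᵇ_; s≤s; s≤s⁻¹)
open import Data.Nat.Properties
  using (+-comm; +-assoc; +-suc; +-identityʳ; *-zeroʳ; *-distribˡ-+; *-comm; *-identityˡ; 0∸n≡0;
         ≤-refl; ≤-trans; <-trans; <-irrefl; <-≤-trans; <⇒≤; ≰⇒>; <-cmp; n<1+n; m<n⇒m<1+n; 1+n≢n;
         m≤m+n; +-monoʳ-≤; +-cancelˡ-≡; ≡ᵇ⇒≡; ≡⇒≡ᵇ; +-0-monoid; +-commutativeSemigroup)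
open import Data.Nat.Combinatorics using (_C_; k>n⇒nCk≡0; nCn≡1; nCk+nC[k+1]≡[n+1]C[k+1])
open import Data.Nat.Tactic.RingSolver using (solve-∀)
open import Algebra.Properties.CommutativeSemigroup +-commutativeSemigroup using (interchange)
open import Algebra.Properties.Monoid.Sum +-0-monoid using (sum; sum-init-last; sum-cong-≗)
open import Data.Fin using (Fin; toℕ; fromℕ; inject₁) renaming (zero to fzero; suc to fsuc)
open import Data.Fin.Properties
  using (toℕ-injective; toℕ-fromℕ<; toℕ-inject₁; toℕ<n; toℕ-fromℕ; inject₁-injective; fromℕ≢inject₁; any?; all?)
  renaming (_≟_ to _≟ᶠ_)
open import Data.Fin.Relation.Unary.Top using (View; view; ‵fromℕ; ‵inj₁; ‵inject₁; view-fromℕ; view-inject₁)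
open import Data.List using (List; []; _∷_; map; concatMap; filter; length; _++_; allFin; tabulate; downFrom)
open import Data.List.Properties using (length-filter; length-tabulate)
open import Data.List.Relation.Unary.All as All using (All; []; _∷_)
import Data.List.Relation.Unary.All.Properties as All
open import Data.List.Relation.Unary.Any as Any using (Any; here; there; _─_)
import Data.List.Relation.Unary.Any.Properties as Any
open import Data.List.Relation.Unary.AllPairs as AllPairs using (AllPairs; []; _∷_)
import Data.List.Relation.Unary.AllPairs.Properties as AllPairsₚ
open import Data.Empty using (⊥; ⊥-elim)
open import Data.Unit using (tt)
open import Data.Product using (_×_; _,_; proj₁; proj₂)
open import Data.Sum using (_⊎_; inj₁; inj₂)
open import Function using (Equivalence)
open import Relation.Nullary using (¬_; yes; no)
open import Relation.Nullary.Decidable using (Dec; toWitness; fromWitness; ⌊_⌋; ¬?; _×-dec_; _→-dec_)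
open import Relation.Binary.Definitions using (tri<; tri≈; tri>)
open import Relation.Binary.PropositionalEquality
  using (_≡_; _≢_; refl; sym; trans; cong; cong₂; subst; module ≡-Reasoning)

open import Defs

open ≡-Reasoning

private
  variable
    A B : Set

[_] : Bool → ℕ
[ true ]  = 1
[ false ] = 0

[T] : ∀ {b} → T b → [ b ] ≡ 1
[T] {true} _ = refl

[¬T] : ∀ {b} → ¬ T b → [ b ] ≡ 0
[¬T] {false} _  = refl
[¬T] {true}  nt = ⊥-elim (nt tt)

sumL : {A : Set} → List A → (A → ℕ) → ℕ
sumL []       f = 0
sumL (x ∷ xs) f = f x + sumL xs f

infix 5 sumL
syntax sumL xs (λ x → e) = ∑[ x ← xs ] e

count : {A : Set} → (A → Bool) → List A → ℕ
count P xs = length (filter (λ x → T? (P x)) xs)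

count≡sum : (P : A → Bool) (xs : List A) → count P xs ≡ ∑[ x ← xs ] [ P x ]
count≡sum P [] = refl
count≡sum P (x ∷ xs) with P x
... | true  = cong suc (count≡sum P xs)
... | false = count≡sum P xs

sum-cong : (xs : List A) {f g : A → ℕ} → (∀ x → f x ≡ g x) → sumL xs f ≡ sumL xs g
sum-cong []       f≡g = refl
sum-cong (x ∷ xs) f≡g = cong₂ _+_ (f≡g x) (sum-cong xs f≡g)

sum-zero : (xs : List A) {f : A → ℕ} → (∀ x → f x ≡ 0) → sumL xs f ≡ 0
sum-zero []       f≡0 = refl
sum-zero (x ∷ xs) f≡0 = cong₂ _+_ (f≡0 x) (sum-zero xs f≡0)

sum-++ : (xs ys : List A) (f : A → ℕ) → sumL (xs ++ ys) f ≡ sumL xs f + sumL ys f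
sum-++ []       ys f = refl
sum-++ (x ∷ xs) ys f = trans (cong (f x +_) (sum-++ xs ys f)) (sym (+-assoc (f x) _ _))

sum-+ : (xs : List A) (f g : A → ℕ) → ∑[ x ← xs ] (f x + g x) ≡ sumL xs f + sumL xs g
sum-+ []       f g = refl
sum-+ (x ∷ xs) f g =
  trans (cong ((f x + g x) +_) (sum-+ xs f g)) (interchange (f x) (g x) (sumL xs f) (sumL xs g))

sum-*ˡ : (xs : List A) (c : ℕ) (f : A → ℕ) → ∑[ x ← xs ] (c * f x) ≡ c * sumL xs f
sum-*ˡ []       c f = sym (*-zeroʳ c)
sum-*ˡ (x ∷ xs) c f = trans (cong (c * f x +_) (sum-*ˡ xs c f)) (sym (*-distribˡ-+ c (f x) _))

sum-*ʳ : (xs : List A) (f : A → ℕ) (c : ℕ) → ∑[ x ← xs ] (f x * c) ≡ sumL xs f * c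
sum-*ʳ xs f c = trans (sum-cong xs (λ x → *-comm (f x) c)) (trans (sum-*ˡ xs c f) (*-comm c (sumL xs f)))

sum-product : (c : ℕ) (xs : List A) (ys : List B) (f : A → ℕ) (g : B → ℕ) →
              ∑[ x ← xs ] ∑[ y ← ys ] c * (f x * g y) ≡ c * (sumL xs f * sumL ys g)
sum-product c xs ys f g = begin
  ∑[ x ← xs ] ∑[ y ← ys ] c * (f x * g y)   ≡⟨ sum-cong xs (λ x → sum-*ˡ ys c (λ y → f x * g y)) ⟩
  ∑[ x ← xs ] c * (∑[ y ← ys ] f x * g y)   ≡⟨ sum-*ˡ xs c _ ⟩
  c * (∑[ x ← xs ] ∑[ y ← ys ] f x * g y)   ≡⟨ cong (c *_) (sum-cong xs (λ x → sum-*ˡ ys (f x) g)) ⟩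
  c * (∑[ x ← xs ] f x * sumL ys g)         ≡⟨ cong (c *_) (sum-*ʳ xs f (sumL ys g)) ⟩
  c * (sumL xs f * sumL ys g)               ∎

sum-map : (xs : List A) (g : A → B) (f : B → ℕ) → sumL (map g xs) f ≡ ∑[ x ← xs ] f (g x)
sum-map []       g f = refl
sum-map (x ∷ xs) g f = cong (f (g x) +_) (sum-map xs g f)

sum-concatMap : (xs : List A) (g : A → List B) (f : B → ℕ) →
                sumL (concatMap g xs) f ≡ ∑[ x ← xs ] sumL (g x) f
sum-concatMap []       g f = refl
sum-concatMap (x ∷ xs) g f =
  trans (sum-++ (g x) (concatMap g xs) f) (cong (sumL (g x) f +_) (sum-concatMap xs g f))

sum-swap : (xs : List A) (ys : List B) (f : A → B → ℕ) →
           ∑[ x ← xs ] ∑[ y ← ys ] f x y ≡ ∑[ y ← ys ] ∑[ x ← xs ] f x y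
sum-swap []       ys f = sym (sum-zero ys (λ _ → refl))
sum-swap (x ∷ xs) ys f =
  trans (cong (sumL ys (f x) +_) (sum-swap xs ys f)) (sym (sum-+ ys (f x) (λ y → sumL xs (λ x′ → f x′ y))))

sum-pull : (xs : List A) (ys : List B) (f : A → ℕ) (g : A → B → ℕ) →
           ∑[ x ← xs ] f x * (∑[ y ← ys ] g x y) ≡ ∑[ y ← ys ] ∑[ x ← xs ] f x * g x y
sum-pull xs ys f g = trans (sum-cong xs (λ x → sym (sum-*ˡ ys (f x) (g x)))) (sum-swap xs ys (λ x y → f x * g x y))

[∧] : ∀ a b → [ a ∧ b ] ≡ [ a ] * [ b ]
[∧] false b = refl
[∧] true  b = sym (+-identityʳ [ b ])

sum-cong-below : ∀ m {f g : ℕ → ℕ} → (∀ p → p < m → f p ≡ g p) → sumL (downFrom m) f ≡ sumL (downFrom m) g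
sum-cong-below zero    _   = refl
sum-cong-below (suc m) f≡g = cong₂ _+_ (f≡g m (n<1+n m)) (sum-cong-below m (λ p p<m → f≡g p (m<n⇒m<1+n p<m)))

[≡ᵇ]-≢ : ∀ {a p} → a ≢ p → [ a ≡ᵇ p ] ≡ 0
[≡ᵇ]-≢ {a} {p} a≢p = [¬T] (λ t → a≢p (≡ᵇ⇒≡ a p t))

[≡ᵇ]-refl : ∀ a → [ a ≡ᵇ a ] ≡ 1
[≡ᵇ]-refl a = [T] (≡⇒≡ᵇ a a refl)

pick-none : ∀ m (f : ℕ → ℕ) {a} → m ≤ a → ∑[ p ← downFrom m ] [ a ≡ᵇ p ] * f p ≡ 0
pick-none zero    f _   = refl
pick-none (suc m) f m<a =
  cong₂ _+_ (cong (_* f m) ([≡ᵇ]-≢ (λ a≡m → <-irrefl (sym a≡m) m<a))) (pick-none m f (<⇒≤ m<a))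

pick : ∀ m (f : ℕ → ℕ) {a} → a < m → ∑[ p ← downFrom m ] [ a ≡ᵇ p ] * f p ≡ f a
pick (suc m) f {a} a<1+m with <-cmp a m
... | tri≈ _ refl _ = begin
  [ a ≡ᵇ a ] * f a + (∑[ p ← downFrom a ] [ a ≡ᵇ p ] * f p)
    ≡⟨ cong₂ _+_ (cong (_* f a) ([≡ᵇ]-refl a)) (pick-none a f ≤-refl) ⟩
  1 * f a + 0   ≡⟨ +-identityʳ (1 * f a) ⟩
  1 * f a       ≡⟨ *-identityˡ (f a) ⟩
  f a           ∎
... | tri< a<m a≢m _ = cong₂ _+_ (cong (_* f m) ([≡ᵇ]-≢ a≢m)) (pick m f a<m)
... | tri> _ _ m<a = ⊥-elim (<-irrefl refl (<-≤-trans m<a (s≤s⁻¹ a<1+m)))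

pick₂ : ∀ n k l v {s a} → s ≤ n → a ≤ n →
  ∑[ p ← downFrom (suc n) ] (p C k) * (∑[ q ← downFrom (suc n) ] (q C l) * [ v ∧ (s ≡ᵇ p) ∧ (a ≡ᵇ q) ])
  ≡ [ v ] * ((s C k) * (a C l))
pick₂ n k l v {s} {a} s≤n a≤n = begin
  ∑[ p ← P ] (p C k) * (∑[ q ← P ] (q C l) * [ v ∧ (s ≡ᵇ p) ∧ (a ≡ᵇ q) ])
    ≡⟨ sum-cong P (λ p → cong ((p C k) *_) (sum-cong P (λ q → factor p q))) ⟩
  ∑[ p ← P ] (p C k) * (∑[ q ← P ] ([ v ] * [ s ≡ᵇ p ]) * ([ a ≡ᵇ q ] * (q C l)))
    ≡⟨ sum-cong P (λ p → cong ((p C k) *_) (trans (sum-*ˡ P ([ v ] * [ s ≡ᵇ p ]) _)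
                                                 (cong (([ v ] * [ s ≡ᵇ p ]) *_) (pick (suc n) (_C l) (s≤s a≤n))))) ⟩
  ∑[ p ← P ] (p C k) * (([ v ] * [ s ≡ᵇ p ]) * (a C l))
    ≡⟨ sum-cong P (λ p → regroup (p C k) [ v ] [ s ≡ᵇ p ] (a C l)) ⟩
  ∑[ p ← P ] ([ v ] * (a C l)) * ([ s ≡ᵇ p ] * (p C k))
    ≡⟨ trans (sum-*ˡ P ([ v ] * (a C l)) _) (cong (([ v ] * (a C l)) *_) (pick (suc n) (_C k) (s≤s s≤n))) ⟩
  ([ v ] * (a C l)) * (s C k)
    ≡⟨ final [ v ] (a C l) (s C k) ⟩
  [ v ] * ((s C k) * (a C l)) ∎
  where
  P = downFrom (suc n)
  factor : ∀ p q → (q C l) * [ v ∧ (s ≡ᵇ p) ∧ (a ≡ᵇ q) ] ≡ ([ v ] * [ s ≡ᵇ p ]) * ([ a ≡ᵇ q ] * (q C l))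
  factor p q = begin
    (q C l) * [ v ∧ (s ≡ᵇ p) ∧ (a ≡ᵇ q) ]
      ≡⟨ cong ((q C l) *_) (trans ([∧] v _) (cong ([ v ] *_) ([∧] (s ≡ᵇ p) (a ≡ᵇ q)))) ⟩
    (q C l) * ([ v ] * ([ s ≡ᵇ p ] * [ a ≡ᵇ q ]))  ≡⟨ shuffle (q C l) [ v ] [ s ≡ᵇ p ] [ a ≡ᵇ q ] ⟩
    ([ v ] * [ s ≡ᵇ p ]) * ([ a ≡ᵇ q ] * (q C l))  ∎
    where
    shuffle : ∀ c x y z → c * (x * (y * z)) ≡ (x * y) * (z * c)
    shuffle = solve-∀
  regroup : ∀ c x y z → c * ((x * y) * z) ≡ (x * z) * (y * c)
  regroup = solve-∀
  final : ∀ x y z → (x * y) * z ≡ x * (z * y)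
  final = solve-∀

sum-except : ∀ m (f g : ℕ → ℕ) {k} → k < m → (∀ p → p < m → p ≢ k → f p ≡ g p) →
             sumL (downFrom m) f + g k ≡ sumL (downFrom m) g + f k
sum-except (suc m) f g {k} k<1+m agree with <-cmp k m
... | tri≈ _ refl _ = begin
  (f k + F) + g k ≡⟨ cong (λ t → (f k + t) + g k)
                       (sum-cong-below k (λ p p<k → agree p (m<n⇒m<1+n p<k) (λ { refl → <-irrefl refl p<k }))) ⟩
  (f k + G) + g k ≡⟨ exchange (f k) G (g k) ⟩
  (g k + G) + f k ∎
  where
  F = sumL (downFrom k) f
  G = sumL (downFrom k) g
  exchange : ∀ x y z → (x + y) + z ≡ (z + y) + x
  exchange = solve-∀
... | tri< k<m k≢m _ = begin
  (f m + F) + g k ≡⟨ +-assoc (f m) F (g k) ⟩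
  f m + (F + g k) ≡⟨ cong₂ _+_ (agree m (n<1+n m) (λ m≡k → k≢m (sym m≡k)))
                               (sum-except m f g k<m (λ p p<m → agree p (m<n⇒m<1+n p<m))) ⟩
  g m + (G + f k) ≡⟨ sym (+-assoc (g m) G (f k)) ⟩
  (g m + G) + f k ∎
  where
  F = sumL (downFrom m) f
  G = sumL (downFrom m) g
... | tri> _ _ m<k = ⊥-elim (<-irrefl refl (<-≤-trans m<k (s≤s⁻¹ k<1+m)))

transform : ℕ → (ℕ → ℕ → ℕ) → ℕ → ℕ → ℕ
transform n c k l = ∑[ p ← downFrom (suc n) ] (p C k) * (∑[ q ← downFrom (suc n) ] (q C l) * c p q)

transform-swap : ∀ n c k l → transform n (λ p q → c q p) k l ≡ transform n c l k
transform-swap n c k l = begin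
  ∑[ p ← P ] (p C k) * (∑[ q ← P ] (q C l) * c q p)
    ≡⟨ sum-pull P P (_C k) (λ p q → (q C l) * c q p) ⟩
  ∑[ q ← P ] ∑[ p ← P ] (p C k) * ((q C l) * c q p)
    ≡⟨ sum-cong P (λ q → sum-cong P (λ p → swap (p C k) (q C l) (c q p))) ⟩
  ∑[ q ← P ] ∑[ p ← P ] (q C l) * ((p C k) * c q p)
    ≡⟨ sum-cong P (λ q → sum-*ˡ P (q C l) (λ p → (p C k) * c q p)) ⟩
  transform n c l k ∎
  where
  P = downFrom (suc n)
  swap : ∀ x y z → x * (y * z) ≡ y * (x * z)
  swap = solve-∀

-- The one-variable binomial transform f ↦ (k ↦ Σ_{p ≤ n} C(p, k) f(p))
-- is injective on functions on {0, …, n}: the system is triangular with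
-- unit diagonal, so f is recovered by downward induction.
binomial-injective : ∀ n (f g : ℕ → ℕ) →
  (∀ k → ∑[ p ← downFrom (suc n) ] (p C k) * f p ≡ ∑[ p ← downFrom (suc n) ] (p C k) * g p) →
  ∀ k → k ≤ n → f k ≡ g k
binomial-injective n f g same k k≤n = downward n k (m≤m+n n k) k≤n
  where
  step : ∀ k → k ≤ n → (∀ p → k < p → p ≤ n → f p ≡ g p) → f k ≡ g k
  step k k≤n above = begin
    f k              ≡⟨ sym (*-identityˡ (f k)) ⟩
    1 * f k          ≡⟨ cong (_* f k) (sym (nCn≡1 k)) ⟩
    (k C k) * f k    ≡⟨ sym (+-cancelˡ-≡ (sumL P wg) _ _ (trans (cong (_+ wg k) (sym (same k))) except)) ⟩
    (k C k) * g k    ≡⟨ cong (_* g k) (nCn≡1 k) ⟩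
    1 * g k          ≡⟨ *-identityˡ (g k) ⟩
    g k              ∎
    where
    P = downFrom (suc n)
    wf wg : ℕ → ℕ
    wf p = (p C k) * f p
    wg p = (p C k) * g p
    agree : ∀ p → p < suc n → p ≢ k → wf p ≡ wg p
    agree p p<1+n p≢k with <-cmp p k
    ... | tri< p<k _ _ = trans (cong (_* f p) (k>n⇒nCk≡0 p<k)) (sym (cong (_* g p) (k>n⇒nCk≡0 p<k)))
    ... | tri≈ _ p≡k _ = ⊥-elim (p≢k p≡k)
    ... | tri> _ _ k<p = cong ((p C k) *_) (above p k<p (s≤s⁻¹ p<1+n))
    except : sumL P wf + wg k ≡ sumL P wg + wf k
    except = sum-except (suc n) wf wg (s≤s k≤n) agree
  -- induction on an upper bound d for the distance n − k
  downward : ∀ d k → n ≤ d + k → k ≤ n → f k ≡ g k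
  downward zero    k n≤k  k≤n = step k k≤n (λ p k<p p≤n → ⊥-elim (<-irrefl refl (<-≤-trans k<p (≤-trans p≤n n≤k))))
  downward (suc d) k n≤1+d+k k≤n = step k k≤n (λ p k<p p≤n →
    downward d p (≤-trans n≤1+d+k (subst (_≤ d + p) (+-suc d k) (+-monoʳ-≤ d k<p))) p≤n)

-- The two-variable transform is injective as well: apply the
-- one-variable statement in each variable in turn.
transform-injective : ∀ n (c c′ : ℕ → ℕ → ℕ) → (∀ k l → transform n c k l ≡ transform n c′ k l) →
  ∀ p q → p ≤ n → q ≤ n → c p q ≡ c′ p q
transform-injective n c c′ same p q p≤n q≤n =
  binomial-injective n (c p) (c′ p) (λ l → rows l p p≤n) q q≤n
  where
  rows : ∀ l p → p ≤ n → ∑[ q ← downFrom (suc n) ] (q C l) * c p q ≡ ∑[ q ← downFrom (suc n) ] (q C l) * c′ p q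
  rows l = binomial-injective n (λ p → ∑[ q ← downFrom (suc n) ] (q C l) * c p q)
                                (λ p → ∑[ q ← downFrom (suc n) ] (q C l) * c′ p q) (λ k → same k l)

-- Two duplicate-free lists that cover each other up to an equivalence _≈_
-- have the same sum for every ≈-invariant weight.  This is the counting
-- principle behind every bijective argument below: enumerations of
-- functions can only be compared up to pointwise equality.
module UpTo {A : Set} (_≈_ : A → A → Set)
            (≈-sym : ∀ {a b} → a ≈ b → b ≈ a)
            (≈-trans : ∀ {a b c} → a ≈ b → b ≈ c → a ≈ c) where

  Distinct : List A → Set
  Distinct = AllPairs (λ a b → ¬ a ≈ b)

  _⊆_ : List A → List A → Set
  xs ⊆ ys = All (λ x → Any (x ≈_) ys) xs

  private
    sum-─ : ∀ {P : A → Set} {ys} (p : Any P ys) (w : A → ℕ) →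
            sumL ys w ≡ w (Any.lookup p) + sumL (ys ─ p) w
    sum-─ (here _) w = refl
    sum-─ {ys = y ∷ ys} (there p) w = begin
      w y + sumL ys w                                   ≡⟨ cong (w y +_) (sum-─ p w) ⟩
      w y + (w (Any.lookup p) + sumL (ys ─ p) w)         ≡⟨ sym (+-assoc (w y) _ _) ⟩
      (w y + w (Any.lookup p)) + sumL (ys ─ p) w         ≡⟨ cong (_+ sumL (ys ─ p) w) (+-comm (w y) _) ⟩
      (w (Any.lookup p) + w y) + sumL (ys ─ p) w         ≡⟨ +-assoc (w (Any.lookup p)) (w y) _ ⟩
      w (Any.lookup p) + (w y + sumL (ys ─ p) w)         ∎

    distinct-─ : ∀ {P : A → Set} {ys} (p : Any P ys) → Distinct ys → Distinct (ys ─ p)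
    distinct-─ (here _)  (_ ∷ d)  = d
    distinct-─ (there p) (a ∷ d) = All.─⁺ p a ∷ distinct-─ p d

    ─-avoids : ∀ {P : A → Set} {ys} (p : Any P ys) → Distinct ys →
               All (λ u → ¬ u ≈ Any.lookup p) (ys ─ p)
    ─-avoids (here _)  (a ∷ _) = All.map (λ ne e → ne (≈-sym e)) a
    ─-avoids (there p) (a ∷ d) = lookup-avoids p a ∷ ─-avoids p d
      where
      lookup-avoids : ∀ {P : A → Set} {y ys} (p : Any P ys) → All (λ b → ¬ y ≈ b) ys →
                      ¬ y ≈ Any.lookup p
      lookup-avoids (here _)  (n ∷ _)  = n
      lookup-avoids (there p) (_ ∷ ns) = lookup-avoids p ns

    any-─ : ∀ {P : A → Set} {ys z} (p : Any P ys) → Any (z ≈_) ys → ¬ z ≈ Any.lookup p →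
            Any (z ≈_) (ys ─ p)
    any-─ (here _)  (here e)  ne = ⊥-elim (ne e)
    any-─ (here _)  (there q) ne = q
    any-─ (there p) (here e)  ne = here e
    any-─ (there p) (there q) ne = there (any-─ p q ne)

  sum-≈ : (w : A → ℕ) → (∀ {a b} → a ≈ b → w a ≡ w b) →
          ∀ xs ys → Distinct xs → Distinct ys → xs ⊆ ys → ys ⊆ xs → sumL xs w ≡ sumL ys w
  sum-≈ w w-inv [] []       _ _ _ _        = refl
  sum-≈ w w-inv [] (y ∷ ys) _ _ _ (() ∷ _)
  sum-≈ w w-inv (x ∷ xs) ys (x∉xs ∷ dxs) dys (x∈ys ∷ xs⊆ys) ys⊆xxs = begin
    w x + sumL xs w                   ≡⟨ cong₂ _+_ (w-inv x≈y) (sum-≈ w w-inv xs (ys ─ x∈ys) dxs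
                                           (distinct-─ x∈ys dys) (shrink xs x∉xs xs⊆ys) ys─y⊆xs) ⟩
    w y + sumL (ys ─ x∈ys) w          ≡⟨ sym (sum-─ x∈ys w) ⟩
    sumL ys w                         ∎
    where
    y = Any.lookup x∈ys
    x≈y : x ≈ y
    x≈y = Any.lookup-result x∈ys
    shrink : ∀ zs → All (λ b → ¬ x ≈ b) zs → zs ⊆ ys → zs ⊆ (ys ─ x∈ys)
    shrink []       _        _        = []
    shrink (z ∷ zs) (n ∷ ns) (q ∷ qs) =
      any-─ x∈ys q (λ z≈y → n (≈-trans x≈y (≈-sym z≈y))) ∷ shrink zs ns qs
    drop-x : ∀ {us} → All (λ u → ¬ u ≈ y) us → All (λ u → Any (u ≈_) (x ∷ xs)) us → us ⊆ xs
    drop-x []       []             = []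
    drop-x (n ∷ ns) (here e  ∷ qs) = ⊥-elim (n (≈-trans e x≈y))
    drop-x (n ∷ ns) (there q ∷ qs) = q ∷ drop-x ns qs
    ys─y⊆xs : (ys ─ x∈ys) ⊆ xs
    ys─y⊆xs = drop-x (─-avoids x∈ys dys) (All.─⁺ x∈ys ys⊆xxs)

record Enumeration : Set₁ where
  field
    Carrier  : Set
    _≈_      : Carrier → Carrier → Set
    ≈-sym    : ∀ {a b} → a ≈ b → b ≈ a
    ≈-trans  : ∀ {a b c} → a ≈ b → b ≈ c → a ≈ c
    elements : List Carrier
  open UpTo _≈_ ≈-sym ≈-trans public
  field
    distinct : Distinct elements
    complete : ∀ a → Any (a ≈_) elements

open Enumeration

module Pairing (X : Enumeration) {B D : Set} (_≈B_ : B → B → Set) (_≈D_ : D → D → Set)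
               (h : Carrier X → B → D) (bs : List B)
               (h-injective : ∀ {a a′ b b′} → h a b ≈D h a′ b′ → _≈_ X a a′ × b ≈B b′) where

  pairs : List D
  pairs = concatMap (λ a → map (h a) bs) (elements X)

  pairs-distinct : AllPairs (λ b b′ → ¬ b ≈B b′) bs → AllPairs (λ d d′ → ¬ d ≈D d′) pairs
  pairs-distinct bs-distinct =
    AllPairsₚ.concat⁺ (All.map⁺ (All.universal row (elements X)))
                     (AllPairsₚ.map⁺ (AllPairs.map across (distinct X)))
    where
    row : ∀ a → AllPairs (λ d d′ → ¬ d ≈D d′) (map (h a) bs)
    row a = AllPairsₚ.map⁺ (AllPairs.map (λ ne e → ne (proj₂ (h-injective e))) bs-distinct)
    across : ∀ {a a′} → ¬ _≈_ X a a′ →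
             All (λ u → All (λ v → ¬ u ≈D v) (map (h a′) bs)) (map (h a) bs)
    across ne = All.map⁺ (All.universal (λ _ → All.map⁺
                  (All.universal (λ _ e → ne (proj₁ (h-injective e))) bs)) bs)

  pairs-complete : (d : D) (a : Carrier X) (b : B) →
                   (∀ {a′ b′} → _≈_ X a a′ → b ≈B b′ → d ≈D h a′ b′) →
                   Any (b ≈B_) bs → Any (d ≈D_) pairs
  pairs-complete d a b d≈h b∈bs =
    Any.concatMap⁺ _ (Any.map (λ a≈a′ → Any.map⁺ (Any.map (d≈h a≈a′) b∈bs)) (complete X a))

module Pointwise (X : Enumeration) (I : Set) where

  _≗_ : (I → Carrier X) → (I → Carrier X) → Set
  f ≗ g = ∀ i → _≈_ X (f i) (g i)

  enumeration : (fs : List (I → Carrier X)) → AllPairs (λ f g → ¬ f ≗ g) fs →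
                (∀ f → Any (f ≗_) fs) → Enumeration
  enumeration fs fs-distinct fs-complete = record
    { Carrier = I → Carrier X ; _≈_ = _≗_
    ; ≈-sym = λ e i → ≈-sym X (e i) ; ≈-trans = λ e e′ i → ≈-trans X (e i) (e′ i)
    ; elements = fs ; distinct = fs-distinct ; complete = fs-complete }

boolEnum : Enumeration
boolEnum = record
  { Carrier = Bool ; _≈_ = _≡_ ; ≈-sym = sym ; ≈-trans = trans
  ; elements = false ∷ true ∷ []
  ; distinct = ((λ ()) ∷ []) ∷ [] ∷ []
  ; complete = λ { false → here refl ; true → there (here refl) } }

finFunEnum : Enumeration → ℕ → Enumeration
finFunEnum X n = Pointwise.enumeration X (Fin n) (allFinFun (elements X) n) (fs-distinct n) (fs-complete n)
  where
  open Pointwise X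
  fs-distinct : ∀ n → AllPairs (λ f g → ¬ _≗_ (Fin n) f g) (allFinFun (elements X) n)
  fs-distinct zero    = [] ∷ []
  fs-distinct (suc n) = Pairing.pairs-distinct X (_≗_ (Fin n)) (_≗_ (Fin (suc n))) _ _
                          (λ e → e fzero , (λ i → e (fsuc i))) (fs-distinct n)
  fs-complete : ∀ n f → Any (_≗_ (Fin n) f) (allFinFun (elements X) n)
  fs-complete zero    f = here (λ ())
  fs-complete (suc n) f = Pairing.pairs-complete X (_≗_ (Fin n)) (_≗_ (Fin (suc n))) _ _
                            (λ e → e fzero , (λ i → e (fsuc i)))
                            f (f fzero) (λ k → f (fsuc k))
                            (λ e e′ → λ { fzero → e ; (fsuc k) → e′ k })
                            (fs-complete n (λ k → f (fsuc k)))

boolFunEnum : Enumeration → Enumeration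
boolFunEnum X = Pointwise.enumeration X Bool (allBoolFun (elements X))
  (Pairing.pairs-distinct X (_≈_ X) _≗_ _ _ (λ e → e false , e true) (distinct X))
  (λ f → Pairing.pairs-complete X (_≈_ X) _≗_ _ _ (λ e → e false , e true) f (f false) (f true)
           (λ e e′ → λ { false → e ; true → e′ }) (complete X (f true)))
  where open Pointwise X Bool

relEnum : ℕ → Enumeration
relEnum n = boolFunEnum (finFunEnum (boolFunEnum (finFunEnum boolEnum n)) n)

subsetEnum : ℕ → Enumeration
subsetEnum n = finFunEnum boolEnum n

record Correspondence (X Y : Enumeration) (P : Carrier X → Bool) (Q : Carrier Y → Bool) : Set where
  field
    to        : Carrier X → Carrier Y
    from      : Carrier Y → Carrier X
    to-resp   : ∀ {a b} → _≈_ X a b → _≈_ Y (to a) (to b)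
    from-resp : ∀ {a b} → _≈_ Y a b → _≈_ X (from a) (from b)
    to-maps   : ∀ a → T (P a) → T (Q (to a))
    from-maps : ∀ b → T (Q b) → T (P (from b))
    from-to   : ∀ a → T (P a) → _≈_ X (from (to a)) a
    to-from   : ∀ b → T (Q b) → _≈_ Y (to (from b)) b

private
  any-filter : {Q : A → Set} (P : A → Bool) {xs : List A} → Any Q xs →
               (∀ {x} → Q x → T (P x)) → Any Q (filter (λ x → T? (P x)) xs)
  any-filter P {x ∷ xs} (here q) Q⇒P with P x | Q⇒P q
  ... | true | _ = here q
  any-filter P {x ∷ xs} (there q) Q⇒P with P x
  ... | true  = there (any-filter P q Q⇒P)
  ... | false = any-filter P q Q⇒P

  length≡sum : (xs : List A) → length xs ≡ ∑[ _ ← xs ] 1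
  length≡sum []       = refl
  length≡sum (x ∷ xs) = cong suc (length≡sum xs)

count-correspondence : (X Y : Enumeration) {P : Carrier X → Bool} {Q : Carrier Y → Bool} →
  (∀ {a b} → _≈_ X a b → T (P a) → T (P b)) → (∀ {a b} → _≈_ Y a b → T (Q a) → T (Q b)) →
  Correspondence X Y P Q → count P (elements X) ≡ count Q (elements Y)
count-correspondence X Y {P} {Q} P-resp Q-resp c = begin
  count P (elements X)                 ≡⟨ length≡sum Xs ⟩
  sumL Xs (λ _ → 1)                    ≡⟨ sym (sum-map Xs to (λ _ → 1)) ⟩
  sumL (map to Xs) (λ _ → 1)           ≡⟨ sum-≈ Y (λ _ → 1) (λ _ → refl) (map to Xs) Ys
                                            (AllPairsₚ.map⁺ (image-distinct PXs (AllPairsₚ.filter⁺ _ (distinct X))))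
                                            (AllPairsₚ.filter⁺ _ (distinct Y))
                                            (image⊆Ys PXs) (Ys⊆image PYs) ⟩
  sumL Ys (λ _ → 1)                    ≡⟨ sym (length≡sum Ys) ⟩
  count Q (elements Y)                 ∎
  where
  open Correspondence c
  Xs = filter (λ x → T? (P x)) (elements X)
  Ys = filter (λ y → T? (Q y)) (elements Y)
  PXs = All.all-filter (λ x → T? (P x)) (elements X)
  PYs = All.all-filter (λ y → T? (Q y)) (elements Y)
  image-distinct : ∀ {zs} → All (λ x → T (P x)) zs → AllPairs (λ a b → ¬ _≈_ X a b) zs →
                   AllPairs (λ a b → ¬ _≈_ Y (to a) (to b)) zs
  image-distinct []       []       = []
  image-distinct (p ∷ ps) (a ∷ as) = All.zipWith separate (ps , a) ∷ image-distinct ps as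
    where
    separate : ∀ {w} → T (P w) × ¬ _≈_ X _ w → ¬ _≈_ Y (to _) (to w)
    separate (q , ne) e = ne (≈-trans X (≈-sym X (from-to _ p)) (≈-trans X (from-resp e) (from-to _ q)))
  image⊆Ys : ∀ {zs} → All (λ x → T (P x)) zs → All (λ y → Any (_≈_ Y y) Ys) (map to zs)
  image⊆Ys []       = []
  image⊆Ys {z ∷ zs} (p ∷ ps) = any-filter Q (complete Y (to z)) (λ e → Q-resp e (to-maps z p)) ∷ image⊆Ys ps
  Ys⊆image : ∀ {zs} → All (λ y → T (Q y)) zs → All (λ y → Any (_≈_ Y y) (map to Xs)) zs
  Ys⊆image []       = []
  Ys⊆image {z ∷ zs} (q ∷ qs) =
    Any.map⁺ (Any.map (λ e → ≈-trans Y (≈-sym Y (to-from z q)) (to-resp e))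
                      (any-filter P (complete X (from z)) (λ e → P-resp e (from-maps z q)))) ∷ Ys⊆image qs

sum-reindex : (X : Enumeration) (h h′ : Carrier X → Carrier X) →
  (∀ {a b} → _≈_ X a b → _≈_ X (h a) (h b)) → (∀ {a b} → _≈_ X a b → _≈_ X (h′ a) (h′ b)) →
  (∀ a → _≈_ X (h (h′ a)) a) → (∀ a → _≈_ X (h′ (h a)) a) →
  (w : Carrier X → ℕ) → (∀ {a b} → _≈_ X a b → w a ≡ w b) →
  sumL (elements X) w ≡ ∑[ a ← elements X ] w (h a)
sum-reindex X h h′ h-resp h′-resp hh′ h′h w w-inv = begin
  sumL (elements X) w          ≡⟨ sym (sum-≈ X w w-inv (map h (elements X)) (elements X)
                                     (AllPairsₚ.map⁺ (AllPairs.map (λ ne e → ne (h-injective e)) (distinct X)))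
                                     (distinct X) (All.map⁺ (All.universal (λ a → complete X (h a)) _))
                                     (All.universal hit _)) ⟩
  sumL (map h (elements X)) w  ≡⟨ sum-map (elements X) h w ⟩
  ∑[ a ← elements X ] w (h a)  ∎
  where
  h-injective : ∀ {a b} → _≈_ X (h a) (h b) → _≈_ X a b
  h-injective e = ≈-trans X (≈-sym X (h′h _)) (≈-trans X (h′-resp e) (h′h _))
  hit : ∀ b → Any (_≈_ X b) (map h (elements X))
  hit b = Any.map⁺ (Any.map (λ e → ≈-trans X (≈-sym X (hh′ b)) (h-resp e)) (complete X (h′ b)))

∧⁻ : ∀ {a b} → T (a ∧ b) → T a × T b
∧⁻ = Equivalence.to T-∧

∧⁺ : ∀ {a b} → T a → T b → T (a ∧ b)
∧⁺ x y = Equivalence.from T-∧ (x , y)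

⇒ᵇ⁻ : ∀ {a b} → T (a ⇒ᵇ b) → T a → T b
⇒ᵇ⁻ {true} h _ = h

⇒ᵇ⁺ : ∀ {a b} → (T a → T b) → T (a ⇒ᵇ b)
⇒ᵇ⁺ {false} _ = tt
⇒ᵇ⁺ {true}  f = f tt

not⁻ : ∀ {a} → T (not a) → ¬ T a
not⁻ {false} _ ()

not⁺ : ∀ {a} → ¬ T a → T (not a)
not⁺ {false} _ = tt
not⁺ {true}  f = f tt

T-ext : ∀ {a b} → (T a → T b) → (T b → T a) → a ≡ b
T-ext {false} {false} _ _ = refl
T-ext {false} {true}  _ g = ⊥-elim (g tt)
T-ext {true}  {false} f _ = ⊥-elim (f tt)
T-ext {true}  {true}  _ _ = refl

¬T⇒false : ∀ {a} → ¬ T a → a ≡ false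
¬T⇒false nt = T-ext (λ x → ⊥-elim (nt x)) (λ ())

count-none : (P : A → Bool) (xs : List A) → (∀ x → ¬ T (P x)) → count P xs ≡ 0
count-none P xs none = trans (count≡sum P xs) (sum-zero xs (λ x → cong [_] (¬T⇒false (none x))))

allL⁻ : (p : A → Bool) (xs : List A) → T (allL p xs) → All (λ x → T (p x)) xs
allL⁻ p []       _ = []
allL⁻ p (x ∷ xs) h = proj₁ (∧⁻ {p x} h) ∷ allL⁻ p xs (proj₂ (∧⁻ {p x} h))

allL⁺ : (p : A → Bool) {xs : List A} → All (λ x → T (p x)) xs → T (allL p xs)
allL⁺ p []       = tt
allL⁺ p (h ∷ hs) = ∧⁺ h (allL⁺ p hs)

allFin⁻ : ∀ {n} (p : Fin n → Bool) → T (allL p (allFin n)) → ∀ i → T (p i)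
allFin⁻ p h = All.tabulate⁻ (allL⁻ p _ h)

allFin⁺ : ∀ {n} (p : Fin n → Bool) → (∀ i → T (p i)) → T (allL p (allFin n))
allFin⁺ p h = allL⁺ p (All.tabulate⁺ h)

allE⁻ : ∀ {n} (p : Bool → Fin n → Bool) → T (allE p) → ∀ σ i → T (p σ i)
allE⁻ p h false = allFin⁻ (p false) (proj₁ (∧⁻ {allL (p false) (allFin _)} h))
allE⁻ p h true  = allFin⁻ (p true) (proj₁ (∧⁻ {allL (p true) (allFin _)} (proj₂ (∧⁻ {allL (p false) (allFin _)} h))))

allE⁺ : ∀ {n} (p : Bool → Fin n → Bool) → (∀ σ i → T (p σ i)) → T (allE p)
allE⁺ p h = ∧⁺ (allFin⁺ (p false) (h false)) (∧⁺ (allFin⁺ (p true) (h true)) tt)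

allE²⁻ : ∀ {n} (p : Bool → Fin n → Bool → Fin n → Bool) →
         T (allE (λ σ i → allE (p σ i))) → ∀ σ i τ j → T (p σ i τ j)
allE²⁻ p h σ i = allE⁻ (p σ i) (allE⁻ (λ σ i → allE (p σ i)) h σ i)

allE²⁺ : ∀ {n} (p : Bool → Fin n → Bool → Fin n → Bool) →
         (∀ σ i τ j → T (p σ i τ j)) → T (allE (λ σ i → allE (p σ i)))
allE²⁺ p h = allE⁺ (λ σ i → allE (p σ i)) (λ σ i → allE⁺ (p σ i) (h σ i))

-- Membership in V_n, as a proposition.  The last field says that no x
-- shares its block with −x; together with the others this is exactly
-- the absence of a zero-block.
record IsV {n} (R : Rel± n) : Set where
  field
    reflexive     : ∀ σ i → T (R σ i σ i)
    symmetric     : ∀ σ i τ j → T (R σ i τ j) → T (R τ j σ i)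
    transitive    : ∀ σ i τ j ρ k → T (R σ i τ j) → T (R τ j ρ k) → T (R σ i ρ k)
    negation      : ∀ σ i τ j → T (R σ i τ j) → T (R (not σ) i (not τ) j)
    no-zero-block : ∀ σ i → ¬ T (R σ i (not σ) i)

open IsV

module _ {n} (R : Rel± n) where

  private
    Refl Sym Trans TypeB ZeroFree : Bool
    Refl     = allE (λ σ i → R σ i σ i)
    Sym      = allE (λ σ i → allE (λ τ j → R σ i τ j ⇒ᵇ R τ j σ i))
    Trans    = allE (λ σ i → allE (λ τ j → allE (λ ρ k → (R σ i τ j ∧ R τ j ρ k) ⇒ᵇ R σ i ρ k)))
    TypeB    = isTypeB R
    ZeroFree = noZeroBlock R

    fields : T (inV R) → T Refl × T Sym × T Trans × T TypeB × T ZeroFree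
    fields h with ∧⁻ {isEquiv R} h
    ... | equiv , rest with ∧⁻ {Refl} equiv | ∧⁻ {TypeB} rest
    ... | r , st | b , z = r , proj₁ (∧⁻ {Sym} st) , proj₂ (∧⁻ {Sym} st) , b , z

  inV⁻ : T (inV R) → IsV R
  inV⁻ h = record
    { reflexive     = allE⁻ (λ σ i → R σ i σ i) r
    ; symmetric     = λ σ i τ j → ⇒ᵇ⁻ (allE²⁻ (λ σ i τ j → R σ i τ j ⇒ᵇ R τ j σ i) s σ i τ j)
    ; transitive    = transitive′
    ; negation      = negation′
    ; no-zero-block = λ σ i x →
        not⁻ (allE⁻ (λ σ i → not (allE (λ τ j → R σ i τ j ⇔ᵇ R σ i (not τ) j))) z σ i)
             (allE⁺ (λ τ j → R σ i τ j ⇔ᵇ R σ i (not τ) j) (λ τ j →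
               ∧⁺ (⇒ᵇ⁺ (to-negated σ i x τ j))
                  (⇒ᵇ⁺ (λ y → subst (λ t → T (R σ i t j)) (not-involutive τ) (to-negated σ i x (not τ) j y)))))
    }
    where
    r = proj₁ (fields h)
    s = proj₁ (proj₂ (fields h))
    t = proj₁ (proj₂ (proj₂ (fields h)))
    b = proj₁ (proj₂ (proj₂ (proj₂ (fields h))))
    z = proj₂ (proj₂ (proj₂ (proj₂ (fields h))))
    transitive′ : ∀ σ i τ j ρ k → T (R σ i τ j) → T (R τ j ρ k) → T (R σ i ρ k)
    transitive′ σ i τ j ρ k x y =
      ⇒ᵇ⁻ (allE⁻ (λ ρ k → (R σ i τ j ∧ R τ j ρ k) ⇒ᵇ R σ i ρ k)
            (allE²⁻ (λ σ i τ j → allE (λ ρ k → (R σ i τ j ∧ R τ j ρ k) ⇒ᵇ R σ i ρ k)) t σ i τ j) ρ k)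
          (∧⁺ x y)
    negation′ : ∀ σ i τ j → T (R σ i τ j) → T (R (not σ) i (not τ) j)
    negation′ σ i τ j = ⇒ᵇ⁻ (proj₁ (∧⁻ (allE²⁻ (λ σ i τ j → R σ i τ j ⇔ᵇ R (not σ) i (not τ) j) b σ i τ j)))
    to-negated : ∀ σ i → T (R σ i (not σ) i) → ∀ τ j → T (R σ i τ j) → T (R σ i (not τ) j)
    to-negated σ i x τ j a = transitive′ σ i (not σ) i (not τ) j x (negation′ σ i τ j a)

  inV⁺ : IsV R → T (inV R)
  inV⁺ v = ∧⁺ (∧⁺ r (∧⁺ s t)) (∧⁺ b z)
    where
    r : T Refl
    r = allE⁺ (λ σ i → R σ i σ i) (reflexive v)
    s : T Sym
    s = allE²⁺ (λ σ i τ j → R σ i τ j ⇒ᵇ R τ j σ i) (λ σ i τ j → ⇒ᵇ⁺ (symmetric v σ i τ j))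
    t : T Trans
    t = allE²⁺ (λ σ i τ j → allE (λ ρ k → (R σ i τ j ∧ R τ j ρ k) ⇒ᵇ R σ i ρ k)) (λ σ i τ j →
          allE⁺ (λ ρ k → (R σ i τ j ∧ R τ j ρ k) ⇒ᵇ R σ i ρ k) (λ ρ k →
            ⇒ᵇ⁺ (λ xy → transitive v σ i τ j ρ k (proj₁ (∧⁻ {R σ i τ j} xy)) (proj₂ (∧⁻ {R σ i τ j} xy)))))
    unnegate : ∀ σ i τ j → T (R (not σ) i (not τ) j) → T (R σ i τ j)
    unnegate σ i τ j x = subst (λ (st : Bool × Bool) → T (R (proj₁ st) i (proj₂ st) j))
                               (cong₂ _,_ (not-involutive σ) (not-involutive τ))
                               (negation v (not σ) i (not τ) j x)
    b : T TypeB
    b = allE²⁺ (λ σ i τ j → R σ i τ j ⇔ᵇ R (not σ) i (not τ) j)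
               (λ σ i τ j → ∧⁺ (⇒ᵇ⁺ (negation v σ i τ j)) (⇒ᵇ⁺ (unnegate σ i τ j)))
    z : T ZeroFree
    z = allE⁺ (λ σ i → not (allE (λ τ j → R σ i τ j ⇔ᵇ R σ i (not τ) j))) (λ σ i →
          not⁺ (λ all → no-zero-block v σ i
            (⇒ᵇ⁻ (proj₁ (∧⁻ (allE⁻ (λ τ j → R σ i τ j ⇔ᵇ R σ i (not τ) j) all σ i))) (reflexive v σ i))))

_≐_ : ∀ {n} → Rel± n → Rel± n → Set
R ≐ R′ = ∀ σ i τ j → R σ i τ j ≡ R′ σ i τ j

≐-transport : ∀ {n} {R R′ : Rel± n} → R ≐ R′ → ∀ {σ i τ j} → T (R σ i τ j) → T (R′ σ i τ j)
≐-transport e {σ} {i} {τ} {j} = subst T (e σ i τ j)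

IsV-resp : ∀ {n} {R R′ : Rel± n} → R ≐ R′ → IsV R → IsV R′
IsV-resp {R = R} {R′} e v = record
  { reflexive     = λ σ i → ≐-transport e (reflexive v σ i)
  ; symmetric     = λ σ i τ j a → ≐-transport e (symmetric v σ i τ j (back a))
  ; transitive    = λ σ i τ j ρ k a b → ≐-transport e (transitive v σ i τ j ρ k (back a) (back b))
  ; negation      = λ σ i τ j a → ≐-transport e (negation v σ i τ j (back a))
  ; no-zero-block = λ σ i a → no-zero-block v σ i (back a)
  }
  where
  back : ∀ {σ i τ j} → T (R′ σ i τ j) → T (R σ i τ j)
  back = ≐-transport (λ σ i τ j → sym (e σ i τ j))

IsV-reindex : ∀ {n n′} (φ : Fin n′ → Fin n) {R : Rel± n} → IsV R → IsV (λ σ i τ j → R σ (φ i) τ (φ j))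
IsV-reindex φ v = record
  { reflexive     = λ σ i → reflexive v σ (φ i)
  ; symmetric     = λ σ i τ j → symmetric v σ (φ i) τ (φ j)
  ; transitive    = λ σ i τ j ρ k → transitive v σ (φ i) τ (φ j) ρ (φ k)
  ; negation      = λ σ i τ j → negation v σ (φ i) τ (φ j)
  ; no-zero-block = λ σ i → no-zero-block v σ (φ i)
  }

Singleton : ∀ {n} → Rel± n → Fin n → Set
Singleton R i = ∀ τ j → T (R false i τ j) → τ ≡ false × j ≡ i

isSingleton⁻ : ∀ {n} (R : Rel± n) i → T (isSingleton R i) → Singleton R i
isSingleton⁻ R i h τ j a
  with ∧⁻ {⌊ false ≟ᵇ τ ⌋} (⇒ᵇ⁻ (allE⁻ (λ τ j → R false i τ j ⇒ᵇ eqE false i τ j) h τ j) a)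
... | σ≡τ , i≡j = sym (toWitness σ≡τ) , sym (toWitness i≡j)

isSingleton⁺ : ∀ {n} (R : Rel± n) i → Singleton R i → T (isSingleton R i)
isSingleton⁺ R i s = allE⁺ (λ τ j → R false i τ j ⇒ᵇ eqE false i τ j) (λ τ j → ⇒ᵇ⁺ (λ a → eq (s τ j a)))
  where
  eq : ∀ {τ j} → τ ≡ false × j ≡ i → T (eqE false i τ j)
  eq (refl , refl) = ∧⁺ (fromWitness {a? = false ≟ᵇ false} refl) (fromWitness {a? = i ≟ᶠ i} refl)

next-inject₁ : ∀ {m} (k : Fin m) → nextMod {suc m} (inject₁ k) ≡ fsuc k
next-inject₁ {m} k with suc (toℕ (inject₁ k)) <? suc m
... | yes p = toℕ-injective (trans (toℕ-fromℕ< p) (cong suc (toℕ-inject₁ k)))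
... | no ¬p = ⊥-elim (¬p (s≤s (subst (_< m) (sym (toℕ-inject₁ k)) (toℕ<n k))))

next-last : ∀ m → nextMod (fromℕ m) ≡ fzero
next-last m with suc (toℕ (fromℕ m)) <? suc m
... | yes p = ⊥-elim (<-irrefl refl (subst (λ t → suc t < suc m) (toℕ-fromℕ m) p))
... | no _  = refl

prevMod : ∀ {m} → Fin (suc m) → Fin (suc m)
prevMod {m} fzero = fromℕ m
prevMod (fsuc k)  = inject₁ k

prev-next : ∀ {m} (i : Fin (suc m)) → prevMod (nextMod i) ≡ i
prev-next i with view i
... | ‵fromℕ      = cong prevMod (next-last _)
... | ‵inject₁ k  = cong prevMod (next-inject₁ k)

next-prev : ∀ {m} (i : Fin (suc m)) → nextMod (prevMod i) ≡ i
next-prev {m} fzero = next-last m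
next-prev (fsuc k)  = next-inject₁ k

next-injective : ∀ {m} {i j : Fin (suc m)} → nextMod i ≡ nextMod j → i ≡ j
next-injective {i = i} {j} e = trans (sym (prev-next i)) (trans (cong prevMod e) (prev-next j))

next-≢ : ∀ {m} (i : Fin (suc (suc m))) → nextMod i ≢ i
next-≢ i with view i
... | ‵fromℕ     = λ e → 0≢last (trans (sym (next-last _)) e)
  where
  0≢last : ∀ {m} → fzero ≢ fromℕ (suc m)
  0≢last ()
... | ‵inject₁ k = λ e → 1+n≢n (trans (cong toℕ (trans (sym (next-inject₁ k)) e)) (toℕ-inject₁ k))

next^ : ∀ {m} → ℕ → Fin (suc m) → Fin (suc m)
next^ zero    x = x
next^ (suc r) x = nextMod (next^ r x)

private
  next^-comm : ∀ {m} r (x : Fin (suc m)) → next^ r (nextMod x) ≡ nextMod (next^ r x)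
  next^-comm zero    x = refl
  next^-comm (suc r) x = cong nextMod (next^-comm r x)

  toℕ-next : ∀ {m} (x : Fin (suc m)) → suc (toℕ x) < suc m → toℕ (nextMod x) ≡ suc (toℕ x)
  toℕ-next {m} x p with suc (toℕ x) <? suc m
  ... | yes q = toℕ-fromℕ< q
  ... | no ¬q = ⊥-elim (¬q p)

  toℕ-next^-0 : ∀ {m} t → t < suc m → toℕ (next^ {m} t fzero) ≡ t
  toℕ-next^-0 zero    _ = refl
  toℕ-next^-0 {m} (suc t) t<n =
    trans (toℕ-next (next^ t fzero) (subst (λ w → suc w < suc m) (sym IH) t<n)) (cong suc IH)
    where
    IH = toℕ-next^-0 t (<-trans (n<1+n t) t<n)

next^-last : ∀ {m} (i : Fin (suc m)) → next^ (suc (toℕ i)) (fromℕ m) ≡ i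
next^-last {m} i = toℕ-injective (begin
  toℕ (nextMod (next^ (toℕ i) (fromℕ m)))  ≡⟨ cong toℕ (sym (next^-comm (toℕ i) (fromℕ m))) ⟩
  toℕ (next^ (toℕ i) (nextMod (fromℕ m)))  ≡⟨ cong (λ w → toℕ (next^ (toℕ i) w)) (next-last m) ⟩
  toℕ (next^ (toℕ i) fzero)                ≡⟨ toℕ-next^-0 (toℕ i) (toℕ<n i) ⟩
  toℕ i                                    ∎)

Sub : ℕ → Set
Sub n = Fin n → Bool

_⊆ᵇ_ : ∀ {n} → Sub n → Sub n → Bool
_⊆ᵇ_ {n} S U = allL (λ i → S i ⇒ᵇ U i) (allFin n)

marked : ∀ {n} → Sub n → Sub n → Rel± n → Bool
marked S A R = inV R ∧ (S ⊆ᵇ isSingleton R ∧ A ⊆ᵇ isAdjacency R)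

N : ∀ n → Sub n → Sub n → ℕ
N n S A = count (marked S A) (allRel± n)

record Marked {n} (S A : Sub n) (R : Rel± n) : Set where
  constructor marks
  field
    isV       : IsV R
    singleton : ∀ i → T (S i) → Singleton R i
    adjacent  : ∀ i → T (A i) → T (R false i false (nextMod i))

module _ {n} (S A : Sub n) (R : Rel± n) where

  marked⁻ : T (marked S A R) → Marked S A R
  marked⁻ h with ∧⁻ {inV R} h
  ... | v , sa with ∧⁻ {S ⊆ᵇ isSingleton R} sa
  ... | s , a = marks (inV⁻ R v)
    (λ i x → isSingleton⁻ R i (⇒ᵇ⁻ (allFin⁻ (λ i → S i ⇒ᵇ isSingleton R i) s i) x))
    (λ i x → ⇒ᵇ⁻ (allFin⁻ (λ i → A i ⇒ᵇ isAdjacency R i) a i) x)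

  marked⁺ : Marked S A R → T (marked S A R)
  marked⁺ (marks v s a) = ∧⁺ (inV⁺ R v)
    (∧⁺ (allFin⁺ (λ i → S i ⇒ᵇ isSingleton R i) (λ i → ⇒ᵇ⁺ (λ x → isSingleton⁺ R i (s i x))))
        (allFin⁺ (λ i → A i ⇒ᵇ isAdjacency R i) (λ i → ⇒ᵇ⁺ (a i))))

Marked-resp : ∀ {n} {S A : Sub n} {R R′ : Rel± n} → R ≐ R′ → Marked S A R → Marked S A R′
Marked-resp e (marks v s a) = marks (IsV-resp e v)
  (λ i x τ j r → s i x τ j (≐-transport (λ σ i τ j → sym (e σ i τ j)) r))
  (λ i x → ≐-transport e (a i x))

N-correspondence : ∀ {n n′} (S A : Sub n) (S′ A′ : Sub n′)
  (f : Rel± n → Rel± n′) (g : Rel± n′ → Rel± n) →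
  (∀ {R R′} → R ≐ R′ → f R ≐ f R′) → (∀ {R R′} → R ≐ R′ → g R ≐ g R′) →
  (∀ R → Marked S A R → Marked S′ A′ (f R)) → (∀ R → Marked S′ A′ R → Marked S A (g R)) →
  (∀ R → Marked S A R → g (f R) ≐ R) → (∀ R → Marked S′ A′ R → f (g R) ≐ R) →
  N n S A ≡ N n′ S′ A′
N-correspondence {n} {n′} S A S′ A′ f g f-resp g-resp f-marks g-marks gf fg =
  count-correspondence (relEnum n) (relEnum n′)
    (λ e x → marked⁺ S A _ (Marked-resp e (marked⁻ S A _ x)))
    (λ e x → marked⁺ S′ A′ _ (Marked-resp e (marked⁻ S′ A′ _ x)))
    (record
      { to = f ; from = g ; to-resp = f-resp ; from-resp = g-resp
      ; to-maps   = λ R x → marked⁺ S′ A′ _ (f-marks R (marked⁻ S A R x))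
      ; from-maps = λ R x → marked⁺ S A _ (g-marks R (marked⁻ S′ A′ R x))
      ; from-to   = λ R x → gf R (marked⁻ S A R x)
      ; to-from   = λ R x → fg R (marked⁻ S′ A′ R x) })

N-cong : ∀ {n} {S A S′ A′ : Sub n} → (∀ i → S i ≡ S′ i) → (∀ i → A i ≡ A′ i) → N n S A ≡ N n S′ A′
N-cong {S = S} {A} {S′} {A′} eS eA = N-correspondence S A S′ A′ (λ R → R) (λ R → R) (λ e → e) (λ e → e)
  (λ R (marks v s a) → marks v (λ i x → s i (subst T (sym (eS i)) x)) (λ i x → a i (subst T (sym (eA i)) x)))
  (λ R (marks v s a) → marks v (λ i x → s i (subst T (eS i) x)) (λ i x → a i (subst T (eA i) x)))
  (λ R _ σ i τ j → refl) (λ R _ σ i τ j → refl)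

N-rotate : ∀ {m} (S A : Sub (suc m)) → N (suc m) S A ≡ N (suc m) (λ i → S (nextMod i)) (λ i → A (nextMod i))
N-rotate S A = N-correspondence S A _ _ (reindex nextMod) (reindex prevMod)
  (λ e σ i τ j → e σ _ τ _) (λ e σ i τ j → e σ _ τ _)
  (λ R (marks v s a) → marks (IsV-reindex nextMod v)
     (λ i x τ j r → let (τ≡ , j≡) = s (nextMod i) x τ (nextMod j) r in τ≡ , next-injective j≡)
     (λ i x → a (nextMod i) x))
  (λ R (marks v s a) → marks (IsV-reindex prevMod v)
     (λ i x τ j r → let (τ≡ , j≡) = s (prevMod i) (subst (λ w → T (S w)) (sym (next-prev i)) x) τ (prevMod j) r
                    in τ≡ , trans (sym (next-prev j)) (trans (cong nextMod j≡) (next-prev i)))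
     (λ i x → subst (λ w → T (R false (prevMod i) false w)) (trans (next-prev i) (sym (prev-next i)))
                (a (prevMod i) (subst (λ w → T (A w)) (sym (next-prev i)) x))))
  (λ R _ σ i τ j → cong₂ (λ a b → R σ a τ b) (next-prev i) (next-prev j))
  (λ R _ σ i τ j → cong₂ (λ a b → R σ a τ b) (prev-next i) (prev-next j))
  where
  reindex : ∀ {m} → (Fin (suc m) → Fin (suc m)) → Rel± (suc m) → Rel± (suc m)
  reindex φ R σ i τ j = R σ (φ i) τ (φ j)

rotate : ∀ {m} → ℕ → Sub (suc m) → Sub (suc m)
rotate r S i = S (next^ r i)

N-rotate^ : ∀ {m} r (S A : Sub (suc m)) → N (suc m) S A ≡ N (suc m) (rotate r S) (rotate r A)
N-rotate^ zero    S A = refl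
N-rotate^ (suc r) S A = trans (N-rotate S A) (N-rotate^ r (λ i → S (nextMod i)) (λ i → A (nextMod i)))

size : ∀ {n} → Sub n → ℕ
size {n} S = count S (allFin n)

private
  sum-tabulate : ∀ {n} (g : Fin n → A) (f : A → ℕ) → sumL (tabulate g) f ≡ sum (λ i → f (g i))
  sum-tabulate {n = zero}  g f = refl
  sum-tabulate {n = suc n} g f = cong (f (g fzero) +_) (sum-tabulate (λ i → g (fsuc i)) f)

size≡sum : ∀ {n} (S : Sub n) → size S ≡ sum (λ i → [ S i ])
size≡sum {n} S = trans (count≡sum S (allFin n)) (sum-tabulate (λ i → i) (λ i → [ S i ]))

size-cong : ∀ {n} {S S′ : Sub n} → (∀ i → S i ≡ S′ i) → size S ≡ size S′
size-cong {S = S} {S′} e = begin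
  size S                   ≡⟨ size≡sum S ⟩
  sum (λ i → [ S i ])      ≡⟨ sum-cong-≗ (λ i → cong [_] (e i)) ⟩
  sum (λ i → [ S′ i ])     ≡⟨ sym (size≡sum S′) ⟩
  size S′                  ∎

size-last : ∀ {m} (S : Sub (suc m)) → size S ≡ size (λ i → S (inject₁ i)) + [ S (fromℕ m) ]
size-last {m} S = begin
  size S                                           ≡⟨ size≡sum S ⟩
  sum (λ i → [ S i ])                              ≡⟨ sum-init-last (λ i → [ S i ]) ⟩
  sum (λ i → [ S (inject₁ i) ]) + [ S (fromℕ m) ]
    ≡⟨ cong (_+ [ S (fromℕ m) ]) (sym (size≡sum (λ i → S (inject₁ i)))) ⟩
  size (λ i → S (inject₁ i)) + [ S (fromℕ m) ]     ∎

size-rotate : ∀ {m} (S : Sub (suc m)) → size (λ i → S (nextMod i)) ≡ size S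
size-rotate {m} S = begin
  size (λ i → S (nextMod i))                                   ≡⟨ size-last (λ i → S (nextMod i)) ⟩
  size (λ i → S (nextMod (inject₁ i))) + [ S (nextMod (fromℕ m)) ]
        ≡⟨ cong₂ _+_ (size-cong (λ i → cong S (next-inject₁ i))) (cong (λ w → [ S w ]) (next-last m)) ⟩
  size (λ i → S (fsuc i)) + [ S fzero ]                        ≡⟨ +-comm _ [ S fzero ] ⟩
  [ S fzero ] + size (λ i → S (fsuc i))                        ≡⟨ cong ([ S fzero ] +_) (size≡sum (λ i → S (fsuc i))) ⟩
  sum (λ i → [ S i ])                                          ≡⟨ sym (size≡sum S) ⟩
  size S                                                       ∎

size-rotate^ : ∀ {m} r (S : Sub (suc m)) → size (rotate r S) ≡ size S
size-rotate^ zero    S = refl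
size-rotate^ (suc r) S = trans (size-rotate^ r (λ i → S (nextMod i))) (size-rotate S)

size-prev : ∀ {m} (S : Sub (suc m)) → size (λ i → S (prevMod i)) ≡ size S
size-prev S = trans (sym (size-rotate (λ i → S (prevMod i)))) (size-cong (λ i → cong S (prev-next i)))

size-empty : ∀ {n} (S : Sub n) → (∀ i → ¬ T (S i)) → size S ≡ 0
size-empty {n} S empty = trans (size≡sum S) (trans (sum-cong-≗ (λ i → cong [_] (¬T⇒false (empty i)))) (zeros n))
  where
  zeros : ∀ n → sum {n} (λ _ → 0) ≡ 0
  zeros zero    = refl
  zeros (suc n) = zeros n

restrict : ∀ {m} → Rel± (suc m) → Rel± m
restrict R σ a τ b = R σ (inject₁ a) τ (inject₁ b)

restrict-IsV : ∀ {m} {R : Rel± (suc m)} → IsV R → IsV (restrict R)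
restrict-IsV = IsV-reindex inject₁

sameSign : Bool → Bool → Bool
sameSign false false = true
sameSign true  true  = true
sameSign _     _     = false

extendView : ∀ {m} → Rel± m → Bool → {i : Fin (suc m)} → View i → Bool → {j : Fin (suc m)} → View j → Bool
extendView R σ (‵inject₁ a) τ (‵inject₁ b) = R σ a τ b
extendView R σ ‵fromℕ       τ ‵fromℕ       = sameSign σ τ
extendView R σ ‵fromℕ       τ (‵inject₁ _) = false
extendView R σ (‵inject₁ _) τ ‵fromℕ       = false

extend : ∀ {m} → Rel± m → Rel± (suc m)
extend R σ i τ j = extendView R σ (view i) τ (view j)

extend-IsV : ∀ {m} {R : Rel± m} → IsV R → IsV (extend R)
extend-IsV {R = R} v = record
  { reflexive = reflexive′ ; symmetric = symmetric′ ; transitive = transitive′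
  ; negation = negation′ ; no-zero-block = no-zero-block′ }
  where
  reflexive′ : ∀ σ i → T (extend R σ i σ i)
  reflexive′ σ i with view i
  ... | ‵inject₁ a = reflexive v σ a
  reflexive′ false i | ‵fromℕ = tt
  reflexive′ true  i | ‵fromℕ = tt
  symmetric′ : ∀ σ i τ j → T (extend R σ i τ j) → T (extend R τ j σ i)
  symmetric′ σ i τ j with view i | view j
  ... | ‵inject₁ a | ‵inject₁ b = symmetric v σ a τ b
  ... | ‵fromℕ     | ‵inject₁ _ = λ ()
  ... | ‵inject₁ _ | ‵fromℕ     = λ ()
  symmetric′ false i false j | ‵fromℕ | ‵fromℕ = _
  symmetric′ true  i true  j | ‵fromℕ | ‵fromℕ = _
  transitive′ : ∀ σ i τ j ρ k → T (extend R σ i τ j) → T (extend R τ j ρ k) → T (extend R σ i ρ k)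
  transitive′ σ i τ j ρ k with view i | view j | view k
  ... | ‵inject₁ a | ‵inject₁ b | ‵inject₁ c = transitive v σ a τ b ρ c
  ... | ‵inject₁ _ | ‵inject₁ _ | ‵fromℕ     = λ _ ()
  ... | ‵inject₁ _ | ‵fromℕ     | _          = λ ()
  ... | ‵fromℕ     | ‵inject₁ _ | _          = λ ()
  ... | ‵fromℕ     | ‵fromℕ     | ‵inject₁ _ = λ _ ()
  transitive′ false i false j false k | ‵fromℕ | ‵fromℕ | ‵fromℕ = λ _ _ → tt
  transitive′ true  i true  j true  k | ‵fromℕ | ‵fromℕ | ‵fromℕ = λ _ _ → tt
  negation′ : ∀ σ i τ j → T (extend R σ i τ j) → T (extend R (not σ) i (not τ) j)
  negation′ σ i τ j with view i | view j
  ... | ‵inject₁ a | ‵inject₁ b = negation v σ a τ b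
  ... | ‵fromℕ     | ‵inject₁ _ = λ ()
  ... | ‵inject₁ _ | ‵fromℕ     = λ ()
  negation′ false i false j | ‵fromℕ | ‵fromℕ = _
  negation′ true  i true  j | ‵fromℕ | ‵fromℕ = _
  no-zero-block′ : ∀ σ i → ¬ T (extend R σ i (not σ) i)
  no-zero-block′ σ i with view i
  ... | ‵inject₁ a = no-zero-block v σ a
  no-zero-block′ false i | ‵fromℕ = λ ()
  no-zero-block′ true  i | ‵fromℕ = λ ()

next-inject₁² : ∀ {m} (c : Fin m) → nextMod {suc (suc m)} (inject₁ (inject₁ c)) ≡ inject₁ (nextMod {suc m} (inject₁ c))
next-inject₁² c = trans (next-inject₁ (inject₁ c)) (cong inject₁ (sym (next-inject₁ c)))

module Deletion {m : ℕ} (S A : Sub (suc (suc m)))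
  (last∈S : T (S (fromℕ (suc m)))) (last∉A : ¬ T (A (fromℕ (suc m))))
  (last-1∉A : ¬ T (A (inject₁ (fromℕ m)))) where

  S′ A′ : Sub (suc m)
  S′ i = S (inject₁ i)
  A′ i = A (inject₁ i)

  private
    last = fromℕ (suc m)

    forward : ∀ R → Marked S A R → Marked S′ A′ (restrict R)
    forward R (marks v s a) = marks (restrict-IsV v)
      (λ i x τ j r → let (τ≡ , j≡) = s (inject₁ i) x τ (inject₁ j) r in τ≡ , inject₁-injective j≡)
      adjacent′
      where
      adjacent′ : ∀ i → T (A′ i) → T (restrict R false i false (nextMod i))
      adjacent′ i x with view i
      ... | ‵fromℕ     = ⊥-elim (last-1∉A x)
      ... | ‵inject₁ c = subst (λ w → T (R false (inject₁ (inject₁ c)) false w)) (next-inject₁² c)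
                               (a (inject₁ (inject₁ c)) x)

    backward : ∀ R → Marked S′ A′ R → Marked S A (extend R)
    backward R (marks v s a) = marks (extend-IsV v) singleton′ adjacent′
      where
      singleton′ : ∀ i → T (S i) → Singleton (extend R) i
      singleton′ i x τ j with view i | view j
      ... | ‵fromℕ     | ‵inject₁ _ = λ ()
      ... | ‵inject₁ _ | ‵fromℕ     = λ ()
      ... | ‵inject₁ a | ‵inject₁ b = λ r → let (τ≡ , j≡) = s a x τ b r in τ≡ , cong inject₁ j≡
      singleton′ i x false j | ‵fromℕ | ‵fromℕ = λ _ → refl , refl
      singleton′ i x true  j | ‵fromℕ | ‵fromℕ = λ ()
      adjacent′ : ∀ i → T (A i) → T (extend R false i false (nextMod i))
      adjacent′ i x with view i
      ... | ‵fromℕ = ⊥-elim (last∉A x)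
      ... | ‵inj₁ {i = a₀} w with view a₀
      ... | ‵fromℕ     = ⊥-elim (last-1∉A x)
      ... | ‵inject₁ c = subst T (sym unfold) (a (inject₁ c) x)
        where
        unfold : extendView R false (‵inj₁ w) false (view (nextMod (inject₁ (inject₁ c))))
                 ≡ R false (inject₁ c) false (nextMod (inject₁ c))
        unfold rewrite next-inject₁² c | view-inject₁ (nextMod (inject₁ c)) = refl

    last-isolated : ∀ R → Marked S A R → ∀ σ τ b → ¬ T (R σ last τ (inject₁ b))
    last-isolated R (marks v s a) false τ b r = fromℕ≢inject₁ (sym (proj₂ (s last last∈S τ (inject₁ b) r)))
    last-isolated R (marks v s a) true  τ b r =
      fromℕ≢inject₁ (sym (proj₂ (s last last∈S (not τ) (inject₁ b) (negation v true last τ _ r))))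

    back-forth : ∀ R → Marked S A R → extend (restrict R) ≐ R
    back-forth R mk σ i τ j with view i | view j
    ... | ‵inject₁ a | ‵inject₁ b = refl
    ... | ‵fromℕ     | ‵inject₁ b = sym (¬T⇒false (last-isolated R mk σ τ b))
    ... | ‵inject₁ a | ‵fromℕ     = sym (¬T⇒false (λ r → last-isolated R mk τ σ a
                                          (symmetric (Marked.isV mk) σ _ τ _ r)))
    ... | ‵fromℕ     | ‵fromℕ     = same σ τ
      where
      v = Marked.isV mk
      same : ∀ σ τ → sameSign σ τ ≡ R σ last τ last
      same false false = sym (T-ext (λ _ → tt) (λ _ → reflexive v false last))
      same true  true  = sym (T-ext (λ _ → tt) (λ _ → reflexive v true last))
      same false true  = sym (¬T⇒false (no-zero-block v false last))
      same true  false = sym (¬T⇒false (no-zero-block v true last))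

    forth-back : ∀ (R : Rel± (suc m)) → restrict (extend R) ≐ R
    forth-back R σ a τ b rewrite view-inject₁ a | view-inject₁ b = refl

    extend-resp : ∀ {R R′ : Rel± (suc m)} → R ≐ R′ → extend R ≐ extend R′
    extend-resp e σ i τ j with view i | view j
    ... | ‵inject₁ a | ‵inject₁ b = e σ a τ b
    ... | ‵fromℕ     | ‵fromℕ     = refl
    ... | ‵fromℕ     | ‵inject₁ _ = refl
    ... | ‵inject₁ _ | ‵fromℕ     = refl

  N-deletion : N (suc (suc m)) S A ≡ N (suc m) S′ A′
  N-deletion = N-correspondence S A S′ A′ restrict extend (λ e σ i τ j → e σ _ τ _)
    (λ {R} {R′} → extend-resp {R} {R′}) forward backward back-forth (λ R _ → forth-back R)

same-row : ∀ {n} {R : Rel± n} → IsV R → ∀ {σ i τ j} → T (R σ i τ j) → ∀ ρ k → R σ i ρ k ≡ R τ j ρ k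
same-row v {σ} {i} {τ} {j} r ρ k =
  T-ext (transitive v τ j σ i ρ k (symmetric v σ i τ j r)) (transitive v σ i τ j ρ k r)

same-column : ∀ {n} {R : Rel± n} → IsV R → ∀ {σ i τ j} → T (R σ i τ j) → ∀ ρ k → R ρ k σ i ≡ R ρ k τ j
same-column v {σ} {i} {τ} {j} r ρ k =
  T-ext (λ x → transitive v ρ k σ i τ j x r) (λ x → transitive v ρ k τ j σ i x (symmetric v σ i τ j r))

collapseView : ∀ {m} {i : Fin (suc (suc m))} → View i → Fin (suc m)
collapseView ‵fromℕ       = fzero
collapseView (‵inject₁ a) = a

collapse : ∀ {m} → Fin (suc (suc m)) → Fin (suc m)
collapse i = collapseView (view i)

collapse-inject₁ : ∀ {m} (a : Fin (suc m)) → collapse (inject₁ a) ≡ a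
collapse-inject₁ a = cong collapseView (view-inject₁ a)

collapse-last : ∀ m → collapse (fromℕ (suc m)) ≡ fzero
collapse-last m = cong collapseView (view-fromℕ (suc m))

merge : ∀ {m} → Rel± (suc m) → Rel± (suc (suc m))
merge R σ i τ j = R σ (collapse i) τ (collapse j)

module Merging {m : ℕ} (S A : Sub (suc (suc m)))
  (last∈A : T (A (fromℕ (suc m)))) (last∉S : ¬ T (S (fromℕ (suc m)))) (0∉S : ¬ T (S fzero)) where

  S′ A′ : Sub (suc m)
  S′ i = S (inject₁ i)
  A′ i = A (inject₁ i)

  private
    last = fromℕ (suc m)

    linked : ∀ {R} → Marked S A R → ∀ σ → T (R σ last σ fzero)
    linked {R} (marks v s a) false = subst (λ w → T (R false last false w)) (next-last (suc m)) (a last last∈A)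
    linked {R} mk@(marks v s a) true = negation v false last false fzero (linked mk false)

    forward : ∀ R → Marked S A R → Marked S′ A′ (restrict R)
    forward R mk@(marks v s a) = marks (restrict-IsV v)
      (λ i x τ j r → let (τ≡ , j≡) = s (inject₁ i) x τ (inject₁ j) r in τ≡ , inject₁-injective j≡)
      adjacent′
      where
      adjacent′ : ∀ i → T (A′ i) → T (restrict R false i false (nextMod i))
      adjacent′ i x with view i
      ... | ‵inject₁ c = subst (λ w → T (R false (inject₁ (inject₁ c)) false w)) (next-inject₁² c)
                               (a (inject₁ (inject₁ c)) x)
      ... | ‵fromℕ = subst (λ w → T (R false (inject₁ (fromℕ m)) false (inject₁ w))) (sym (next-last m))
          (transitive v false _ false last false fzero
            (subst (λ w → T (R false (inject₁ (fromℕ m)) false w)) (next-inject₁ (fromℕ m)) (a (inject₁ (fromℕ m)) x))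
            (linked mk false))

    backward : ∀ R → Marked S′ A′ R → Marked S A (merge R)
    backward R (marks v s a) = marks (IsV-reindex collapse v) singleton′ adjacent′
      where
      singleton′ : ∀ i → T (S i) → Singleton (merge R) i
      singleton′ i x τ j r with view i
      ... | ‵fromℕ      = ⊥-elim (last∉S x)
      ... | ‵inject₁ a₀ = lift (view j) (s a₀ x τ (collapse j) r)
        where
        lift : ∀ {j} → View j → τ ≡ false × collapseView (view j) ≡ a₀ → τ ≡ false × j ≡ inject₁ a₀
        lift {j} ‵fromℕ (_ , j≡) =
          ⊥-elim (0∉S (subst (λ w → T (S (inject₁ w))) (trans (sym j≡) (collapse-last m)) x))
        lift {j} (‵inject₁ b) (τ≡ , j≡) = τ≡ , cong inject₁ (trans (sym (collapse-inject₁ b)) j≡)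
      adjacent′ : ∀ i → T (A i) → T (merge R false i false (nextMod i))
      adjacent′ i x with view i
      ... | ‵fromℕ = subst (λ w → T (R false fzero false (collapse w))) (sym (next-last (suc m)))
                           (reflexive v false fzero)
      ... | ‵inj₁ {i = a₀} _ with view a₀
      ... | ‵fromℕ = subst (λ w → T (R false (fromℕ m) false w))
                           (trans (next-last m) (sym (trans (cong collapse (next-inject₁ (fromℕ m))) (collapse-last m))))
                           (a (fromℕ m) x)
      ... | ‵inject₁ c = subst (λ w → T (R false (inject₁ c) false w))
                               (sym (trans (cong collapse (next-inject₁² c)) (collapse-inject₁ (nextMod (inject₁ c)))))
                               (a (inject₁ c) x)

    back-forth : ∀ R → Marked S A R → merge (restrict R) ≐ R
    back-forth R mk σ i τ j = trans (rows (view i)) (columns (view j))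
      where
      v = Marked.isV mk
      rows : ∀ {i} → View i → R σ (inject₁ (collapse i)) τ (inject₁ (collapse j)) ≡ R σ i τ (inject₁ (collapse j))
      rows ‵fromℕ rewrite collapse-last m = sym (same-row v (linked mk σ) τ _)
      rows (‵inject₁ b) rewrite collapse-inject₁ b = refl
      columns : ∀ {j} → View j → R σ i τ (inject₁ (collapse j)) ≡ R σ i τ j
      columns ‵fromℕ rewrite collapse-last m = sym (same-column v (linked mk τ) σ i)
      columns (‵inject₁ b) rewrite collapse-inject₁ b = refl

    forth-back : ∀ (R : Rel± (suc m)) → restrict (merge R) ≐ R
    forth-back R σ a τ b = cong₂ (λ u w → R σ u τ w) (collapse-inject₁ a) (collapse-inject₁ b)

  N-merging : N (suc (suc m)) S A ≡ N (suc m) S′ A′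
  N-merging = N-correspondence S A S′ A′ restrict merge (λ e σ i τ j → e σ _ τ _) (λ e σ i τ j → e σ _ τ _)
    forward backward back-forth (λ R _ → forth-back R)

Compatible : ∀ {m} → Sub (suc m) → Sub (suc m) → Set
Compatible S A = ∀ i → T (S i) → ¬ T (A i) × ¬ T (A (prevMod i))

compatible? : ∀ {m} (S A : Sub (suc m)) → Dec (Compatible S A)
compatible? S A = all? (λ i → T? (S i) →-dec (¬? (T? (A i)) ×-dec ¬? (T? (A (prevMod i)))))

-- For n ≥ 2 a singleton cannot be adjacent to anything else.
marked-compatible : ∀ {m} {S A : Sub (suc (suc m))} {R} → Marked S A R → Compatible S A
marked-compatible {A = A} {R} (marks v s a) i i∈S = i∉A , i-1∉A
  where
  i∉A : ¬ T (A i)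
  i∉A x = next-≢ i (proj₂ (s i i∈S false (nextMod i) (a i x)))
  i-1∉A : ¬ T (A (prevMod i))
  i-1∉A x = next-≢ i (trans (cong nextMod (sym prev≡i)) (next-prev i))
    where
    r : T (R false (prevMod i) false i)
    r = subst (λ w → T (R false (prevMod i) false w)) (next-prev i) (a (prevMod i) x)
    prev≡i : prevMod i ≡ i
    prev≡i = proj₂ (s i i∈S false (prevMod i) (symmetric v false (prevMod i) false i r))

N-incompatible : ∀ {m} (S A : Sub (suc (suc m))) → ¬ Compatible S A → N (suc (suc m)) S A ≡ 0
N-incompatible {m} S A ¬c = count-none (marked S A) (allRel± (suc (suc m))) (λ R x → ¬c (marked-compatible (marked⁻ S A R x)))

compatible-rotate : ∀ {m} {S A : Sub (suc m)} → Compatible S A →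
                    Compatible (λ i → S (nextMod i)) (λ i → A (nextMod i))
compatible-rotate {A = A} c i x with c (nextMod i) x
... | i∉A , i-1∉A = i∉A , subst (λ w → ¬ T (A w)) (trans (prev-next i) (sym (next-prev i))) i-1∉A

compatible-rotate^ : ∀ {m} r {S A : Sub (suc m)} → Compatible S A → Compatible (rotate r S) (rotate r A)
compatible-rotate^ zero    c = c
compatible-rotate^ (suc r) c = compatible-rotate^ r (compatible-rotate c)

-- Dropping the last index keeps compatibility, provided the new cyclic
-- neighbour m+1 of the first index is not an obstruction.
compatible-restrict : ∀ {m} {S A : Sub (suc (suc m))} → Compatible S A →
  (T (S fzero) → ¬ T (A (inject₁ (fromℕ m)))) → Compatible (λ i → S (inject₁ i)) (λ i → A (inject₁ i))
compatible-restrict c h fzero    x = proj₁ (c fzero x) , h x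
compatible-restrict c h (fsuc k) x = c (fsuc (inject₁ k)) x

compatible-dual : ∀ {m} {S A : Sub (suc m)} → Compatible S A → Compatible (λ i → A (prevMod i)) S
compatible-dual c i x = (λ i∈S → proj₂ (c i i∈S) x) , (λ i-1∈S → proj₁ (c (prevMod i) i-1∈S) x)

compatible-dual⁻¹ : ∀ {m} {S A : Sub (suc m)} → Compatible (λ i → A (prevMod i)) S → Compatible S A
compatible-dual⁻¹ {S = S} {A} c i x =
  (λ i∈A → proj₂ (c (nextMod i) (subst (λ w → T (A w)) (sym (prev-next i)) i∈A))
                 (subst (λ w → T (S w)) (sym (prev-next i)) x)) ,
  (λ i-1∈A → proj₁ (c i i-1∈A) x)

#V : ℕ → ℕ
#V n = count inV (allRel± n)

N-unmarked : ∀ n → N n (λ _ → false) (λ _ → false) ≡ #V n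
N-unmarked n = trans (count≡sum _ (allRel± n))
  (trans (sum-cong (allRel± n) (λ R → cong [_] (no-marks R))) (sym (count≡sum inV (allRel± n))))
  where
  no-marks : ∀ R → marked {n} (λ _ → false) (λ _ → false) R ≡ inV R
  no-marks R = T-ext (λ x → proj₁ (∧⁻ {inV R} x)) (λ x → ∧⁺ {inV R} x (∧⁺ {(λ _ → false) ⊆ᵇ isSingleton R}
                   (allFin⁺ (λ i → false ⇒ᵇ isSingleton R i) (λ _ → tt))
                   (allFin⁺ (λ i → false ⇒ᵇ isAdjacency R i) (λ _ → tt))))

-- For n = 1 the only partition has both a singleton and an adjacency pair.
N-one : ∀ (S A : Sub 1) → N 1 S A ≡ 1
N-one S A = trans (N-cong {n = 1} {S} {A} {λ _ → S fzero} {λ _ → A fzero} (λ { fzero → refl }) (λ { fzero → refl }))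
                  (constant (S fzero) (A fzero))
  where
  constant : ∀ s a → N 1 (λ _ → s) (λ _ → a) ≡ 1
  constant false false = refl
  constant false true  = refl
  constant true  false = refl
  constant true  true  = refl

#V-≤1 : ∀ t → #V (1 ∸ t) ≡ 1
#V-≤1 zero    = refl
#V-≤1 (suc t) = cong #V (0∸n≡0 t)

record Reduction (m : ℕ) (S A : Sub (suc (suc m))) : Set where
  field
    S′ A′      : Sub (suc m)
    N-eq       : N (suc (suc m)) S A ≡ N (suc m) S′ A′
    size-eq    : size S + size A ≡ suc (size S′ + size A′)
    compatible : Compatible S′ A′

private
  one-fewer : ∀ {m} (S A : Sub (suc m)) → [ S (fromℕ m) ] + [ A (fromℕ m) ] ≡ 1 →
              size S + size A ≡ suc (size (λ i → S (inject₁ i)) + size (λ i → A (inject₁ i)))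
  one-fewer {m} S A one = begin
    size S + size A                               ≡⟨ cong₂ _+_ (size-last S) (size-last A) ⟩
    (s′ + [ S (fromℕ m) ]) + (a′ + [ A (fromℕ m) ]) ≡⟨ interchange s′ _ a′ _ ⟩
    (s′ + a′) + ([ S (fromℕ m) ] + [ A (fromℕ m) ]) ≡⟨ cong ((s′ + a′) +_) one ⟩
    (s′ + a′) + 1                                 ≡⟨ +-comm (s′ + a′) 1 ⟩
    suc (s′ + a′)                                 ∎
    where
    s′ = size (λ i → S (inject₁ i))
    a′ = size (λ i → A (inject₁ i))

  rotated-sizes : ∀ {m} r (S A : Sub (suc m)) → size S + size A ≡ size (rotate r S) + size (rotate r A)
  rotated-sizes r S A = sym (cong₂ _+_ (size-rotate^ r S) (size-rotate^ r A))

-- a marked singleton: rotate it to the last position and delete it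
reduce-singleton : ∀ {m} (S A : Sub (suc (suc m))) → Compatible S A → ∀ i → T (S i) → Reduction m S A
reduce-singleton {m} S A c i i∈S = record
  { S′ = Deletion.S′ S″ A″ last∈S last∉A last-1∉A
  ; A′ = Deletion.A′ S″ A″ last∈S last∉A last-1∉A
  ; N-eq = trans (N-rotate^ r S A) (Deletion.N-deletion S″ A″ last∈S last∉A last-1∉A)
  ; size-eq = trans (rotated-sizes r S A) (one-fewer S″ A″ (cong₂ _+_ ([T] last∈S) ([¬T] last∉A)))
  ; compatible = compatible-restrict c″ (λ _ → last-1∉A) }
  where
  r = suc (toℕ i)
  S″ = rotate r S
  A″ = rotate r A
  c″ = compatible-rotate^ r c
  last∈S : T (S″ (fromℕ (suc m)))
  last∈S = subst (λ w → T (S w)) (sym (next^-last i)) i∈S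
  last∉A = proj₁ (c″ (fromℕ (suc m)) last∈S)
  last-1∉A = proj₂ (c″ (fromℕ (suc m)) last∈S)

-- a marked adjacency: rotate it to start at the last position and merge
reduce-adjacency : ∀ {m} (S A : Sub (suc (suc m))) → Compatible S A → ∀ i → T (A i) → Reduction m S A
reduce-adjacency {m} S A c i i∈A = record
  { S′ = Merging.S′ S″ A″ last∈A last∉S 0∉S
  ; A′ = Merging.A′ S″ A″ last∈A last∉S 0∉S
  ; N-eq = trans (N-rotate^ r S A) (Merging.N-merging S″ A″ last∈A last∉S 0∉S)
  ; size-eq = trans (rotated-sizes r S A) (one-fewer S″ A″ (cong₂ _+_ ([¬T] last∉S) ([T] last∈A)))
  ; compatible = compatible-restrict c″ (λ 0∈S → ⊥-elim (0∉S 0∈S)) }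
  where
  r = suc (toℕ i)
  S″ = rotate r S
  A″ = rotate r A
  c″ = compatible-rotate^ r c
  last∈A : T (A″ (fromℕ (suc m)))
  last∈A = subst (λ w → T (A w)) (sym (next^-last i)) i∈A
  last∉S : ¬ T (S″ (fromℕ (suc m)))
  last∉S x = proj₁ (c″ (fromℕ (suc m)) x) last∈A
  0∉S : ¬ T (S″ fzero)
  0∉S x = proj₂ (c″ fzero x) last∈A

reduction-closed-form : ∀ {m} {S A : Sub (suc (suc m))} (r : Reduction m S A) →
  let open Reduction r in N (suc m) S′ A′ ≡ #V (suc m ∸ (size S′ + size A′)) →
  N (suc (suc m)) S A ≡ #V (suc (suc m) ∸ (size S + size A))
reduction-closed-form {m} r closed = let open Reduction r in
  trans N-eq (trans closed (cong (λ t → #V (suc (suc m) ∸ t)) (sym size-eq)))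

N-compatible : ∀ m (S A : Sub (suc m)) → Compatible S A → N (suc m) S A ≡ #V (suc m ∸ (size S + size A))
N-compatible zero S A _ = trans (N-one S A) (sym (#V-≤1 (size S + size A)))
N-compatible (suc m) S A c with any? (λ i → T? (S i)) | any? (λ i → T? (A i))
... | yes (i , i∈S) | _ = reduction-closed-form r (N-compatible m S′ A′ compatible)
  where
  r = reduce-singleton S A c i i∈S
  open Reduction r
... | no _ | yes (i , i∈A) = reduction-closed-form r (N-compatible m S′ A′ compatible)
  where
  r = reduce-adjacency S A c i i∈A
  open Reduction r
... | no S≡∅ | no A≡∅ = begin
  N (suc (suc m)) S A                         ≡⟨ N-cong (λ i → ¬T⇒false (λ x → S≡∅ (i , x)))
                                                        (λ i → ¬T⇒false (λ x → A≡∅ (i , x))) ⟩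
  N (suc (suc m)) (λ _ → false) (λ _ → false) ≡⟨ N-unmarked (suc (suc m)) ⟩
  #V (suc (suc m))                             ≡⟨ cong (λ t → #V (suc (suc m) ∸ t))
                                                   (sym (cong₂ _+_ (size-empty S (λ i x → S≡∅ (i , x)))
                                                                   (size-empty A (λ i x → A≡∅ (i , x))))) ⟩
  #V (suc (suc m) ∸ (size S + size A))         ∎

N-dual : ∀ m (S A : Sub (suc m)) → N (suc m) S A ≡ N (suc m) (λ i → A (prevMod i)) S
N-dual zero S A = trans (N-one S A) (sym (N-one (λ i → A (prevMod i)) S))
N-dual (suc m) S A with compatible? S A
... | no ¬c = trans (N-incompatible S A ¬c)
                    (sym (N-incompatible (λ i → A (prevMod i)) S (λ c → ¬c (compatible-dual⁻¹ c))))
... | yes c = begin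
  N n S A                                       ≡⟨ N-compatible (suc m) S A c ⟩
  #V (n ∸ (size S + size A))                    ≡⟨ cong (λ t → #V (n ∸ t)) (+-comm (size S) (size A)) ⟩
  #V (n ∸ (size A + size S))                     ≡⟨ cong (λ t → #V (n ∸ (t + size S))) (sym (size-prev A)) ⟩
  #V (n ∸ (size A⁻ + size S))                    ≡⟨ sym (N-compatible (suc m) A⁻ S (compatible-dual c)) ⟩
  N n A⁻ S                                      ∎
  where
  n = suc (suc m)
  A⁻ = λ i → A (prevMod i)

subsets : (n : ℕ) → List (Sub n)
subsets n = elements (subsetEnum n)

cons : ∀ {n} → A → (Fin n → A) → Fin (suc n) → A
cons a f fzero    = a
cons a f (fsuc i) = f i

private
  allL-tabulate : ∀ {m} {p : A → Bool} {q : B → Bool} (g : Fin m → A) (h : Fin m → B) →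
                  (∀ i → p (g i) ≡ q (h i)) → allL p (tabulate g) ≡ allL q (tabulate h)
  allL-tabulate {m = zero}  g h e = refl
  allL-tabulate {m = suc m} g h e = cong₂ _∧_ (e fzero) (allL-tabulate (λ i → g (fsuc i)) (λ i → h (fsuc i)) (λ i → e (fsuc i)))

⊆ᵇ-cons : ∀ {n} (a : Bool) (f : Sub n) (U : Sub (suc n)) →
          (cons a f ⊆ᵇ U) ≡ (a ⇒ᵇ U fzero) ∧ (f ⊆ᵇ (λ i → U (fsuc i)))
⊆ᵇ-cons a f U = cong ((a ⇒ᵇ U fzero) ∧_)
  (allL-tabulate {p = λ i → cons a f i ⇒ᵇ U i} {q = λ i → f i ⇒ᵇ U (fsuc i)} fsuc (λ i → i) (λ i → refl))

size-cons : ∀ {n} (a : Bool) (f : Sub n) → size (cons a f) ≡ [ a ] + size f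
size-cons a f = trans (size≡sum (cons a f)) (cong ([ a ] +_) (sym (size≡sum f)))

⊆ᵇ-cong : ∀ {n} {F G : Sub n} (U : Sub n) → (∀ i → F i ≡ G i) → F ⊆ᵇ U ≡ G ⊆ᵇ U
⊆ᵇ-cong U e = allL-tabulate (λ i → i) (λ i → i) (λ i → cong (_⇒ᵇ U i) (e i))

sum-allFinFun-suc : (xs : List A) (n : ℕ) (w : (Fin (suc n) → A) → ℕ) →
  (∀ {F G} → (∀ i → F i ≡ G i) → w F ≡ w G) →
  sumL (allFinFun xs (suc n)) w ≡ ∑[ a ← xs ] ∑[ f ← allFinFun xs n ] w (cons a f)
sum-allFinFun-suc xs n w w-resp =
  trans (sum-concatMap xs _ w) (sum-cong xs (λ a → trans (sum-map (allFinFun xs n) _ w)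
    (sum-cong (allFinFun xs n) (λ f → w-resp (λ { fzero → refl ; (fsuc k) → refl })))))

sum-subsets-suc : ∀ n (w : Sub (suc n) → ℕ) → (∀ {F G} → (∀ i → F i ≡ G i) → w F ≡ w G) →
  sumL (subsets (suc n)) w ≡ (∑[ f ← subsets n ] w (cons false f)) + (∑[ f ← subsets n ] w (cons true f))
sum-subsets-suc n w w-resp =
  trans (sum-allFinFun-suc (false ∷ true ∷ []) n w w-resp) (cong ((∑[ f ← subsets n ] w (cons false f)) +_) (+-identityʳ _))

count-subsets : ∀ n (U : Sub n) k → ∑[ S ← subsets n ] [ S ⊆ᵇ U ∧ (size S ≡ᵇ k) ] ≡ size U C k
count-subsets zero    U zero    = refl
count-subsets zero    U (suc k) = refl
count-subsets (suc n) U k = begin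
  ∑[ S ← subsets (suc n) ] w S
    ≡⟨ sum-subsets-suc n w w-resp ⟩
  (∑[ f ← subsets n ] w (cons false f)) + (∑[ f ← subsets n ] w (cons true f))
    ≡⟨ cong₂ _+_ (trans (sum-cong (subsets n) (w-cons false)) (count-subsets n U′ k))
                 (trans (sum-cong (subsets n) (w-cons true)) (with-first (U fzero) k)) ⟩
  size U′ C k + extra (U fzero) k
    ≡⟨ sym (pascal (U fzero) k) ⟩
  ([ U fzero ] + size U′) C k
    ≡⟨ cong (_C k) (sym (size-cons (U fzero) U′)) ⟩
  size (cons (U fzero) U′) C k
    ≡⟨ cong (_C k) (size-cong {S = cons (U fzero) U′} {U} (λ { fzero → refl ; (fsuc i) → refl })) ⟩
  size U C k ∎
  where
  U′ : Sub n
  U′ i = U (fsuc i)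
  w : Sub (suc n) → ℕ
  w S = [ S ⊆ᵇ U ∧ (size S ≡ᵇ k) ]
  w-resp : ∀ {F G} → (∀ i → F i ≡ G i) → w F ≡ w G
  w-resp e = cong₂ (λ a b → [ a ∧ b ]) (⊆ᵇ-cong U e) (cong (_≡ᵇ k) (size-cong e))
  w-cons : ∀ a f → w (cons a f) ≡ [ ((a ⇒ᵇ U fzero) ∧ (f ⊆ᵇ U′)) ∧ (([ a ] + size f) ≡ᵇ k) ]
  w-cons a f = cong₂ (λ x y → [ x ∧ (y ≡ᵇ k) ]) (⊆ᵇ-cons a f U) (size-cons a f)
  extra : Bool → ℕ → ℕ
  extra true (suc k) = size U′ C k
  extra _    _       = 0
  with-first : ∀ b k → ∑[ f ← subsets n ] [ (b ∧ (f ⊆ᵇ U′)) ∧ (suc (size f) ≡ᵇ k) ] ≡ extra b k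
  with-first false k       = sum-zero (subsets n) (λ _ → refl)
  with-first true  zero    = sum-zero (subsets n) (λ f → cong [_] (∧-zeroʳ (f ⊆ᵇ U′)))
  with-first true  (suc k) = count-subsets n U′ k
  pascal : ∀ b k → ([ b ] + size U′) C k ≡ size U′ C k + extra b k
  pascal false k       = sym (+-identityʳ _)
  pascal true  zero    = refl
  pascal true  (suc k) = trans (sym (nCk+nC[k+1]≡[n+1]C[k+1] (size U′) k)) (+-comm (size U′ C k) _)

-- E n k l = Σ_{|S| = k, |A| = l} N(S, A) counts the triples (π, S, A) with
-- π ∈ V_n, S a k-set of singleton pairs and A an l-set of adjacency pairs of π.
E : ℕ → ℕ → ℕ → ℕ
E n k l = ∑[ S ← subsets n ] ∑[ A ← subsets n ] ([ size S ≡ᵇ k ] * [ size A ≡ᵇ l ]) * N n S A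

-- By duality, E is symmetric in k and l.
E-symmetric : ∀ m k l → E (suc m) k l ≡ E (suc m) l k
E-symmetric m k l = begin
  E n k l
    ≡⟨ sum-cong (subsets n) (λ S → sum-cong (subsets n) (λ A → cong (w S A *_) (N-dual m S A))) ⟩
  ∑[ S ← subsets n ] ∑[ A ← subsets n ] w S A * N n (λ i → A (prevMod i)) S
    ≡⟨ sum-cong (subsets n) (λ S → sum-reindex (subsetEnum n) rot unrot (λ e i → e (nextMod i)) (λ e i → e (prevMod i))
                             (λ A i → cong A (prev-next i)) (λ A i → cong A (next-prev i)) (F S) (F-resp S)) ⟩
  ∑[ S ← subsets n ] ∑[ A ← subsets n ] F S (rot A)
    ≡⟨ sum-cong (subsets n) (λ S → sum-cong (subsets n) (λ A → cong₂ _*_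
         (cong (λ t → [ size S ≡ᵇ k ] * [ t ≡ᵇ l ]) (size-rotate A))
         (N-cong (λ i → cong A (next-prev i)) (λ i → refl)))) ⟩
  ∑[ S ← subsets n ] ∑[ A ← subsets n ] w S A * N n A S
    ≡⟨ sum-swap (subsets n) (subsets n) (λ S A → w S A * N n A S) ⟩
  ∑[ A ← subsets n ] ∑[ S ← subsets n ] w S A * N n A S
    ≡⟨ sum-cong (subsets n) (λ A → sum-cong (subsets n) (λ S →
         cong (_* N n A S) (*-comm [ size S ≡ᵇ k ] [ size A ≡ᵇ l ]))) ⟩
  E n l k ∎
  where
  n = suc m
  w : Sub n → Sub n → ℕ
  w S A = [ size S ≡ᵇ k ] * [ size A ≡ᵇ l ]
  rot unrot : Sub n → Sub n
  rot A i = A (nextMod i)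
  unrot A i = A (prevMod i)
  F : Sub n → Sub n → ℕ
  F S A = w S A * N n (unrot A) S
  F-resp : ∀ S {A A′} → (∀ i → A i ≡ A′ i) → F S A ≡ F S A′
  F-resp S e = cong₂ (λ t u → ([ size S ≡ᵇ k ] * [ t ≡ᵇ l ]) * u) (size-cong e) (N-cong (λ i → e (prevMod i)) (λ i → refl))

E-double-count : ∀ n k l → E n k l ≡ ∑[ R ← allRel± n ] [ inV R ] * ((sStat R C k) * (aStat R C l))
E-double-count n k l = begin
  E n k l
    ≡⟨ sum-cong (subsets n) (λ S → sum-cong (subsets n) (λ A →
         trans (cong (w S A *_) (count≡sum (marked S A) (allRel± n))) (sym (sum-*ˡ (allRel± n) (w S A) _)))) ⟩
  ∑[ S ← subsets n ] ∑[ A ← subsets n ] ∑[ R ← allRel± n ] w S A * [ marked S A R ]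
    ≡⟨ sum-cong (subsets n) (λ S → sum-cong (subsets n) (λ A → sum-cong (allRel± n) (λ R → indicators S A R))) ⟩
  ∑[ S ← subsets n ] ∑[ A ← subsets n ] ∑[ R ← allRel± n ] [ inV R ] * (sub S R * adj A R)
    ≡⟨ sum-cong (subsets n) (λ S → sum-swap (subsets n) (allRel± n) _) ⟩
  ∑[ S ← subsets n ] ∑[ R ← allRel± n ] ∑[ A ← subsets n ] [ inV R ] * (sub S R * adj A R)
    ≡⟨ sum-swap (subsets n) (allRel± n) _ ⟩
  ∑[ R ← allRel± n ] ∑[ S ← subsets n ] ∑[ A ← subsets n ] [ inV R ] * (sub S R * adj A R)
    ≡⟨ sum-cong (allRel± n) (λ R → sum-product [ inV R ] (subsets n) (subsets n) (λ S → sub S R) (λ A → adj A R)) ⟩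
  ∑[ R ← allRel± n ] [ inV R ] * ((∑[ S ← subsets n ] sub S R) * (∑[ A ← subsets n ] adj A R))
    ≡⟨ sum-cong (allRel± n) (λ R → cong ([ inV R ] *_)
         (cong₂ _*_ (count-subsets n (isSingleton R) k) (count-subsets n (isAdjacency R) l))) ⟩
  ∑[ R ← allRel± n ] [ inV R ] * ((sStat R C k) * (aStat R C l)) ∎
  where
  w : Sub n → Sub n → ℕ
  w S A = [ size S ≡ᵇ k ] * [ size A ≡ᵇ l ]
  sub adj : Sub n → Rel± n → ℕ
  sub S R = [ S ⊆ᵇ isSingleton R ∧ (size S ≡ᵇ k) ]
  adj A R = [ A ⊆ᵇ isAdjacency R ∧ (size A ≡ᵇ l) ]
  indicators : ∀ S A R → w S A * [ marked S A R ] ≡ [ inV R ] * (sub S R * adj A R)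
  indicators S A R = begin
    ([ y ] * [ u ]) * [ v ∧ (x ∧ z) ]              ≡⟨ cong (([ y ] * [ u ]) *_) (trans ([∧] v (x ∧ z)) (cong ([ v ] *_) ([∧] x z))) ⟩
    ([ y ] * [ u ]) * ([ v ] * ([ x ] * [ z ]))    ≡⟨ rearrange [ v ] [ x ] [ y ] [ z ] [ u ] ⟩
    [ v ] * (([ x ] * [ y ]) * ([ z ] * [ u ]))    ≡⟨ sym (cong ([ v ] *_) (cong₂ _*_ ([∧] x y) ([∧] z u))) ⟩
    [ v ] * ([ x ∧ y ] * [ z ∧ u ])                ∎
    where
    v = inV R
    x = S ⊆ᵇ isSingleton R
    y = size S ≡ᵇ k
    z = A ⊆ᵇ isAdjacency R
    u = size A ≡ᵇ l
    rearrange : ∀ v x y z u → (y * u) * (v * (x * z)) ≡ v * ((x * y) * (z * u))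
    rearrange = solve-∀

private
  sStat≤ : ∀ {n} (R : Rel± n) → sStat R ≤ n
  sStat≤ {n} R = subst (sStat R ≤_) (length-tabulate (λ i → i)) (length-filter _ (allFin n))

  aStat≤ : ∀ {n} (R : Rel± n) → aStat R ≤ n
  aStat≤ {n} R = subst (aStat R ≤_) (length-tabulate (λ i → i)) (length-filter _ (allFin n))

-- The binomial transform of the coefficients of P_n is Σ_{π ∈ V_n} C(s_π, k) C(a_π, l):
-- the indicator of (s_π, a_π) = (p, q) picks out a single term.
transform-coeffP : ∀ n k l → transform n (coeffP n) k l ≡ ∑[ R ← allRel± n ] [ inV R ] * ((sStat R C k) * (aStat R C l))
transform-coeffP n k l = begin
  ∑[ p ← P ] (p C k) * (∑[ q ← P ] (q C l) * coeffP n p q)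
    ≡⟨ sum-cong P (λ p → cong ((p C k) *_) (sum-cong P (λ q → cong ((q C l) *_) (count≡sum (has p q) (allRel± n))))) ⟩
  ∑[ p ← P ] (p C k) * (∑[ q ← P ] (q C l) * (∑[ R ← allRel± n ] [ has p q R ]))
    ≡⟨ sum-cong P (λ p → cong ((p C k) *_) (sum-pull P (allRel± n) (_C l) (λ q R → [ has p q R ]))) ⟩
  ∑[ p ← P ] (p C k) * (∑[ R ← allRel± n ] ∑[ q ← P ] (q C l) * [ has p q R ])
    ≡⟨ sum-pull P (allRel± n) (_C k) (λ p R → ∑[ q ← P ] (q C l) * [ has p q R ]) ⟩
  ∑[ R ← allRel± n ] ∑[ p ← P ] (p C k) * (∑[ q ← P ] (q C l) * [ has p q R ])
    ≡⟨ sum-cong (allRel± n) (λ R → pick₂ n k l (inV R) (sStat≤ R) (aStat≤ R)) ⟩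
  ∑[ R ← allRel± n ] [ inV R ] * ((sStat R C k) * (aStat R C l)) ∎
  where
  P = downFrom (suc n)
  has : ℕ → ℕ → Rel± n → Bool
  has p q R = inV R ∧ (sStat R ≡ᵇ p) ∧ (aStat R ≡ᵇ q)

transform-coeffP≡E : ∀ n k l → transform n (coeffP n) k l ≡ E n k l
transform-coeffP≡E n k l = trans (transform-coeffP n k l) (sym (E-double-count n k l))

coeffP-beyond : ∀ n p q → n < p ⊎ n < q → coeffP n p q ≡ 0
coeffP-beyond n p q beyond = count-none _ (allRel± n) (λ R x → impossible R beyond (∧⁻ (proj₂ (∧⁻ {inV R} x))))
  where
  impossible : ∀ R → n < p ⊎ n < q → T (sStat R ≡ᵇ p) × T (aStat R ≡ᵇ q) → ⊥
  impossible R (inj₁ n<p) (s≡p , _) = <-irrefl refl (<-≤-trans n<p (subst (_≤ n) (≡ᵇ⇒≡ (sStat R) p s≡p) (sStat≤ R)))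
  impossible R (inj₂ n<q) (_ , a≡q) = <-irrefl refl (<-≤-trans n<q (subst (_≤ n) (≡ᵇ⇒≡ (aStat R) q a≡q) (aStat≤ R)))

-- Inside {0, …, n}² the coefficients are determined by their binomial
-- transform E, which is symmetric; outside, both sides vanish.
theorem2p1 : (n : ℕ) → 1 ≤ n → (p q : ℕ) → coeffP n p q ≡ coeffP n q p
theorem2p1 (suc m) _ p q with p ≤? suc m | q ≤? suc m
... | yes p≤n | yes q≤n = transform-injective n (coeffP n) (λ p q → coeffP n q p) transforms p q p≤n q≤n
  where
  n = suc m
  transforms : ∀ k l → transform n (coeffP n) k l ≡ transform n (λ p q → coeffP n q p) k l
  transforms k l = begin
    transform n (coeffP n) k l              ≡⟨ transform-coeffP≡E n k l ⟩
    E n k l                                 ≡⟨ E-symmetric m k l ⟩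
    E n l k                                 ≡⟨ sym (transform-coeffP≡E n l k) ⟩
    transform n (coeffP n) l k              ≡⟨ sym (transform-swap n (coeffP n) k l) ⟩
    transform n (λ p q → coeffP n q p) k l  ∎
... | no p≰n | _ = trans (coeffP-beyond (suc m) p q (inj₁ (≰⇒> p≰n))) (sym (coeffP-beyond (suc m) q p (inj₂ (≰⇒> p≰n))))
... | _ | no q≰n = trans (coeffP-beyond (suc m) p q (inj₂ (≰⇒> q≰n))) (sym (coeffP-beyond (suc m) q p (inj₁ (≰⇒> q≰n))))
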